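{- Let $G$ be a $4$-chordal graph. Let $C$ be a maximal $3$-clique of $G$ if $G$ has one; otherwise let $C$ be a clique of $G$ with at least four vertices. Then $G$ admits a nice tree-decomposition whose root corresponds to $C$ (i.e., the set associated with the root is exactly the vertex set of $C$).
   Context: All graphs are finite and simple. A clique is a complete subgraph; a $k$-clique is a clique on $k$ vertices; a clique is maximal if it is inclusion-wise maximal among complete subgraphs. A graph is chordal if it has no induced cycle of length at least four; a chordal graph is $4$-chordal if every edge lies in a $4$-clique. A tree-decomposition of a graph $G$ is a tree $T$ with a set $V_u\subseteq V(G)$ associated with each node $u$ of $T$ such that: two vertices $v,v'$ of $G$ are adjacent if and only if there is a node $u$ with $\{v,v'\}\subseteq V_u$; and for every vertex $v$ of $G$, the nodes $u$ with $v\in V_u$ induce a subtree of $T$. Each $V_u$ induces a clique, and $u$ is said to correspond to that clique. A tree-decomposition of a $4$-chordal graph is nice if it is rooted and: (1) no two adjacent nodes are associated with the same set; (2) every node $u$ has $|V_u|\ge 3$, and if $|V_u|=3$ then $V_u$ induces a maximal clique of $G$; (3) if $|V_u|=k\ge 5$ and $u$ is not the root, then $k-1$ vertices of $V_u$ belong to the set associated with the parent of $u$; (4) if $G$ contains a maximal $3$-clique, then the root corresponds to a maximal $3$-clique. -}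

module Defs where

open import Data.Nat using (ℕ; zero; suc; _≤_; _∸_)
open import Data.Fin using (Fin; toℕ) renaming (zero to fzero; suc to fsuc)
open import Data.Fin.Subset using (Subset; _∈_; _∉_; _⊆_; _∩_; ∣_∣)
open import Data.Bool using (Bool; true; false)
open import Data.Product using (Σ; ∃; _×_; _,_)
open import Data.Sum using (_⊎_)
open import Relation.Binary.PropositionalEquality using (_≡_; _≢_)
open import Relation.Nullary using (¬_)
open import Function.Bundles using (_⇔_)
open import Function.Definitions using (Injective)

record Graph (n : ℕ) : Set where
  field
    adj     : Fin n → Fin n → Bool
    adj-sym : ∀ u v → adj u v ≡ adj v u
    adj-irr : ∀ u → adj u u ≡ false

module _ {n : ℕ} (G : Graph n) where
  open Graph G

  Adj : Fin n → Fin n → Set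
  Adj u v = adj u v ≡ true

  IsClique : Subset n → Set
  IsClique C = ∀ u v → u ∈ C → v ∈ C → u ≢ v → Adj u v

  IsMaximalClique : Subset n → Set
  IsMaximalClique C = IsClique C × (∀ D → IsClique D → C ⊆ D → D ⊆ C)

  IsMaximal3Clique : Subset n → Set
  IsMaximal3Clique C = IsMaximalClique C × ∣ C ∣ ≡ 3

  HasMaximal3Clique : Set
  HasMaximal3Clique = ∃ λ C → IsMaximal3Clique C

  CycNext : {k : ℕ} → Fin k → Fin k → Set
  CycNext {k} i j = (suc (toℕ i) ≡ toℕ j) ⊎ (suc (toℕ i) ≡ k × toℕ j ≡ 0)

  CycAdj : {k : ℕ} → Fin k → Fin k → Set
  CycAdj i j = CycNext i j ⊎ CycNext j i

  IsInducedCycle : (k : ℕ) → (Fin k → Fin n) → Set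
  IsInducedCycle k c = Injective _≡_ _≡_ c × (∀ i j → Adj (c i) (c j) ⇔ CycAdj i j)

  Chordal : Set
  Chordal = ∀ k → 4 ≤ k → (c : Fin k → Fin n) → ¬ IsInducedCycle k c

  FourChordal : Set
  FourChordal = Chordal ×
    (∀ u v → Adj u v → ∃ λ K → IsClique K × ∣ K ∣ ≡ 4 × u ∈ K × v ∈ K)

-- Rooted trees on node set Fin (suc m), root = fzero.  Node (fsuc i) has
-- parent (parent i), which has a smaller index (every finite rooted tree
-- can be so labelled, e.g. in BFS order).

record RootedTree : Set where
  field
    m         : ℕ
    parent    : Fin m → Fin (suc m)
    parent-lt : ∀ i → toℕ (parent i) ≤ toℕ i

  Node : Set
  Node = Fin (suc m)

  root : Node
  root = fzero

  TAdj : Node → Node → Set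
  TAdj a b = ∃ λ i → (a ≡ fsuc i × b ≡ parent i) ⊎ (b ≡ fsuc i × a ≡ parent i)

  data PathIn (P : Node → Set) : Node → Node → Set where
    here : ∀ {a} → P a → PathIn P a a
    step : ∀ {a b c} → P a → TAdj a b → PathIn P b c → PathIn P a c

  InducesSubtree : (Node → Set) → Set
  InducesSubtree P = ∀ a b → P a → P b → PathIn P a b

record TreeDecomposition {n : ℕ} (G : Graph n) : Set where
  field
    tree : RootedTree
  open RootedTree tree public
  field
    bag      : Node → Subset n
    adj-iff  : ∀ v v' → v ≢ v' → Adj G v v' ⇔ (∃ λ u → v ∈ bag u × v' ∈ bag u)
    subtree  : ∀ v → InducesSubtree (λ u → v ∈ bag u)

module _ {n : ℕ} {G : Graph n} (T : TreeDecomposition G) where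
  open TreeDecomposition T

  IsNice : Set
  IsNice =
    -- (1) adjacent nodes carry different sets
    (∀ i → bag (fsuc i) ≢ bag (parent i)) ×
    -- (2) every bag has at least 3 vertices, and 3-bags are maximal cliques
    (∀ u → 3 ≤ ∣ bag u ∣ × (∣ bag u ∣ ≡ 3 → IsMaximalClique G (bag u))) ×
    -- (3) a non-root bag of size k ≥ 5 shares exactly k-1 vertices with its parent
    (∀ i → 5 ≤ ∣ bag (fsuc i) ∣ →
       ∣ bag (fsuc i) ∩ bag (parent i) ∣ ≡ ∣ bag (fsuc i) ∣ ∸ 1) ×
    -- (4) if G has a maximal 3-clique, the root corresponds to one
    (HasMaximal3Clique G → IsMaximal3Clique G (bag root))

module Submission where

-- Let V₀ be the set of non-isolated vertices.  4-chordality makes every maximal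
-- clique of G[V₀] good: it has at least four vertices or is a maximal 3-clique.
-- For every S ⊇ C all of whose maximal cliques are good we build, by induction
-- on |S|, a rooted tree of cliques with root bag C that satisfies niceness
-- conditions (1)–(3) and contains every clique of G[S] in some bag.  For S ≠ C,
-- chordality provides a leaf clique K of G[S], hanging from a clique P, whose
-- vertices outside P have all their neighbours in K (a Dirac-style argument:
-- otherwise a shortest path closed up through one vertex is an induced cycle).
-- Removing those vertices, decomposing the rest and hanging K back on through
-- bags that grow one vertex at a time completes the step.

open import Defs
open import Data.Nat using (ℕ; zero; suc; _≤_; _<_; _∸_; _+_; z≤n; s≤s)
import Data.Nat.Properties as ℕP
open import Data.Fin using (Fin; toℕ; inject₁; fromℕ) renaming (zero to fzero; suc to fsuc)
import Data.Fin.Properties as FP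
open import Data.Fin.Subset using (Subset; _∈_; _∉_; _⊆_; _∩_; _∪_; _─_; _-_; ∣_∣; ⁅_⁆; inside; outside)
import Data.Fin.Subset.Properties as SP
open import Data.Vec using (_∷_; tabulate; here; there)
import Data.Vec.Properties as VP
open import Data.Bool using (true) renaming (_≟_ to _≟ᵇ_)
open import Data.Product using (Σ; ∃; _×_; _,_; proj₁; proj₂)
open import Data.Sum using (_⊎_; inj₁; inj₂; [_,_]′)
open import Data.Empty using (⊥; ⊥-elim)
open import Relation.Binary.PropositionalEquality using (_≡_; _≢_; refl; sym; trans; cong; subst)
open import Relation.Binary using (tri<; tri≈; tri>)
open import Relation.Nullary using (¬_; Dec; yes; no; does)
open import Relation.Nullary.Decidable using (dec-true; ¬?; _×-dec_; _⊎-dec_; _→-dec_)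
open import Relation.Unary using (Decidable)
open import Function.Bundles using (_⇔_; mk⇔)

module Subsets {n : ℕ} where

  -- The subset { x | P x } of a decidable predicate; kept opaque so that
  -- only its membership rules are ever used.
  opaque
    setOf : {P : Fin n → Set} → Decidable P → Subset n
    setOf d = tabulate (λ x → does (d x))

    ∈setOf⁺ : {P : Fin n → Set} (d : Decidable P) {x : Fin n} → P x → x ∈ setOf d
    ∈setOf⁺ d {x} px = VP.lookup⇒[]= x _ (trans (VP.lookup∘tabulate _ x) (dec-true (d x) px))

    ∈setOf⁻ : {P : Fin n → Set} (d : Decidable P) {x : Fin n} → x ∈ setOf d → P x
    ∈setOf⁻ {P} d {x} x∈ = fromDoes (d x) (trans (sym (VP.lookup∘tabulate (λ y → does (d y)) x)) (VP.[]=⇒lookup x∈))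
      where
      fromDoes : (dx : Dec (P x)) → does dx ≡ true → P x
      fromDoes (yes p) _ = p
      fromDoes (no _) ()

  -- Membership is decidable, so a failed inclusion has an explicit witness.
  ⊈⇒witness : {p q : Subset n} → ¬ (q ⊆ p) → ∃ λ x → x ∈ q × x ∉ p
  ⊈⇒witness {p} {q} q⊈p with FP.any? (λ x → x SP.∈? q ×-dec ¬? (x SP.∈? p))
  ... | yes witness = witness
  ... | no none = ⊥-elim (q⊈p q⊆p)
    where
    q⊆p : q ⊆ p
    q⊆p {x} x∈q with x SP.∈? p
    ... | yes x∈p = x∈p
    ... | no x∉p = ⊥-elim (none (x , x∈q , x∉p))

  larger⇒witness : {p q : Subset n} → ∣ p ∣ < ∣ q ∣ → ∃ λ x → x ∈ q × x ∉ p
  larger⇒witness lt = ⊈⇒witness (λ q⊆p → ℕP.<⇒≱ lt (SP.p⊆q⇒∣p∣≤∣q∣ q⊆p))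

  proper⇒smaller : {p q : Subset n} {x : Fin n} → p ⊆ q → x ∈ q → x ∉ p → ∣ p ∣ < ∣ q ∣
  proper⇒smaller p⊆q x∈q x∉p = SP.p⊂q⇒∣p∣<∣q∣ (p⊆q , _ , x∈q , x∉p)

  nonempty⇒positive : {p : Subset n} {x : Fin n} → x ∈ p → 1 ≤ ∣ p ∣
  nonempty⇒positive {p} x∈p =
    subst (_< ∣ p ∣) (SP.∣⊥∣≡0 n) (proper⇒smaller (λ x∈⊥ → ⊥-elim (SP.∉⊥ x∈⊥)) x∈p SP.∉⊥)

  ∣p∪⁅x⁆∣≡1+∣p∣ : ∀ {m} (p : Subset m) (x : Fin m) → x ∉ p → ∣ p ∪ ⁅ x ⁆ ∣ ≡ suc ∣ p ∣
  ∣p∪⁅x⁆∣≡1+∣p∣ (outside ∷ p) fzero x∉p rewrite SP.∪-identityʳ p = refl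
  ∣p∪⁅x⁆∣≡1+∣p∣ (inside ∷ p) fzero x∉p = ⊥-elim (x∉p here)
  ∣p∪⁅x⁆∣≡1+∣p∣ (outside ∷ p) (fsuc x) x∉p = ∣p∪⁅x⁆∣≡1+∣p∣ p x (λ x∈p → x∉p (there x∈p))
  ∣p∪⁅x⁆∣≡1+∣p∣ (inside ∷ p) (fsuc x) x∉p = cong suc (∣p∪⁅x⁆∣≡1+∣p∣ p x (λ x∈p → x∉p (there x∈p)))

  ∣p∪⁅x⁆∣≤1+∣p∣ : (p : Subset n) (x : Fin n) → ∣ p ∪ ⁅ x ⁆ ∣ ≤ suc ∣ p ∣
  ∣p∪⁅x⁆∣≤1+∣p∣ p x with x SP.∈? p
  ... | no x∉p = ℕP.≤-reflexive (∣p∪⁅x⁆∣≡1+∣p∣ p x x∉p)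
  ... | yes x∈p = ℕP.m≤n⇒m≤1+n (SP.p⊆q⇒∣p∣≤∣q∣ absorbed)
    where
    absorbed : p ∪ ⁅ x ⁆ ⊆ p
    absorbed y∈ = [ (λ y∈p → y∈p) , (λ y∈⁅x⁆ → subst (_∈ p) (sym (SP.x∈⁅y⁆⇒x≡y x y∈⁅x⁆)) x∈p) ]′ (SP.x∈p∪q⁻ p ⁅ x ⁆ y∈)

  ∈p∪⁅x⁆⁻ : {p : Subset n} {x y : Fin n} → y ∈ p ∪ ⁅ x ⁆ → y ∈ p ⊎ y ≡ x
  ∈p∪⁅x⁆⁻ {p} {x} y∈ = Data.Sum.map (λ y∈p → y∈p) (SP.x∈⁅y⁆⇒x≡y x) (SP.x∈p∪q⁻ p ⁅ x ⁆ y∈)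

  x∈p∪⁅x⁆ : {p : Subset n} {x : Fin n} → x ∈ p ∪ ⁅ x ⁆
  x∈p∪⁅x⁆ {p} {x} = SP.q⊆p∪q p ⁅ x ⁆ (SP.x∈⁅x⁆ x)

  p⊆p∪⁅x⁆ : {p : Subset n} {x : Fin n} → p ⊆ p ∪ ⁅ x ⁆
  p⊆p∪⁅x⁆ {x = x} = SP.p⊆p∪q ⁅ x ⁆

  ∈p─q⇒∉q : ∀ {m} (p q : Subset m) {x : Fin m} → x ∈ p ─ q → x ∉ q
  ∈p─q⇒∉q (_ ∷ p) (_ ∷ q) (there x∈) (there x∈q) = ∈p─q⇒∉q p q x∈ x∈q

  ∈p-y⁻ : {p : Subset n} {x y : Fin n} → x ∈ p - y → x ∈ p × x ≢ y
  ∈p-y⁻ {p} {x} {y} x∈ = SP.p─q⊆p p ⁅ y ⁆ x∈ , λ x≡y → ∈p─q⇒∉q p ⁅ y ⁆ x∈ (subst (_∈ ⁅ y ⁆) (sym x≡y) (SP.x∈⁅x⁆ y))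

  third-element : {p : Subset n} → 3 ≤ ∣ p ∣ → (x y : Fin n) → ∃ λ z → z ∈ p × z ≢ x × z ≢ y
  third-element {p} three x y with larger⇒witness {p = ⁅ x ⁆ ∪ ⁅ y ⁆} (ℕP.≤-trans (s≤s pair≤2) three)
    where
    pair≤2 : ∣ ⁅ x ⁆ ∪ ⁅ y ⁆ ∣ ≤ 2
    pair≤2 = subst (λ k → ∣ ⁅ x ⁆ ∪ ⁅ y ⁆ ∣ ≤ suc k) (SP.∣⁅x⁆∣≡1 x) (∣p∪⁅x⁆∣≤1+∣p∣ ⁅ x ⁆ y)
  ... | z , z∈p , z∉pair =
    z , z∈p , (λ z≡x → z∉pair (SP.x∈p∪q⁺ (inj₁ (subst (_∈ ⁅ x ⁆) (sym z≡x) (SP.x∈⁅x⁆ x)))))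
             , (λ z≡y → z∉pair (SP.x∈p∪q⁺ (inj₂ (subst (_∈ ⁅ y ⁆) (sym z≡y) (SP.x∈⁅x⁆ y)))))

  three-distinct⇒3≤∣p∣ : {p : Subset n} {x y z : Fin n} → x ∈ p → y ∈ p → z ∈ p →
                          x ≢ y → x ≢ z → y ≢ z → 3 ≤ ∣ p ∣
  three-distinct⇒3≤∣p∣ {p} {x} {y} {z} x∈p y∈p z∈p x≢y x≢z y≢z =
    subst (_≤ ∣ p ∣) ∣triple∣≡3 (SP.p⊆q⇒∣p∣≤∣q∣ triple⊆p)
    where
    pair = ⁅ x ⁆ ∪ ⁅ y ⁆
    y∉⁅x⁆ : y ∉ ⁅ x ⁆
    y∉⁅x⁆ = SP.x≢y⇒x∉⁅y⁆ (λ e → x≢y (sym e))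
    z∉pair : z ∉ pair
    z∉pair z∈ with ∈p∪⁅x⁆⁻ {p = ⁅ x ⁆} z∈
    ... | inj₁ z∈⁅x⁆ = x≢z (sym (SP.x∈⁅y⁆⇒x≡y x z∈⁅x⁆))
    ... | inj₂ z≡y = y≢z (sym z≡y)
    ∣triple∣≡3 : ∣ pair ∪ ⁅ z ⁆ ∣ ≡ 3
    ∣triple∣≡3 = trans (∣p∪⁅x⁆∣≡1+∣p∣ pair z z∉pair)
                   (cong suc (trans (∣p∪⁅x⁆∣≡1+∣p∣ ⁅ x ⁆ y y∉⁅x⁆) (cong suc (SP.∣⁅x⁆∣≡1 x))))
    triple⊆p : pair ∪ ⁅ z ⁆ ⊆ p
    triple⊆p w∈ with ∈p∪⁅x⁆⁻ {p = pair} w∈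
    ... | inj₂ refl = z∈p
    ... | inj₁ w∈pair with ∈p∪⁅x⁆⁻ {p = ⁅ x ⁆} w∈pair
    ...   | inj₂ refl = y∈p
    ...   | inj₁ w∈⁅x⁆ rewrite SP.x∈⁅y⁆⇒x≡y x w∈⁅x⁆ = x∈p

module GraphFacts {n : ℕ} (G : Graph n) where
  open Graph G

  adj? : (u v : Fin n) → Dec (Adj G u v)
  adj? u v = adj u v ≟ᵇ true

  Adj-sym : {u v : Fin n} → Adj G u v → Adj G v u
  Adj-sym {u} {v} e = trans (sym (adj-sym u v)) e

  Adj-irrefl : {u : Fin n} → ¬ Adj G u u
  Adj-irrefl {u} e with trans (sym (adj-irr u)) e
  ... | ()

  Adj⇒≢ : {u v : Fin n} → Adj G u v → u ≢ v
  Adj⇒≢ e refl = Adj-irrefl e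

  Complete : Fin n → Subset n → Set
  Complete y M = ∀ m → m ∈ M → Adj G m y

  clique-⊆ : {C D : Subset n} → D ⊆ C → IsClique G C → IsClique G D
  clique-⊆ D⊆C C-clique u v u∈D v∈D = C-clique u v (D⊆C u∈D) (D⊆C v∈D)

-- Breadth-first search from s inside a vertex set Z (with s ∈ Z).  The balls
-- give the component of s in G[Z]; the layers give shortest, hence induced,
-- paths.
module BreadthFirst {n : ℕ} (G : Graph n) (Z : Subset n) (s : Fin n) (s∈Z : s ∈ Z) where
  open Subsets {n}
  open GraphFacts G

  opaque
    Ball : ℕ → Subset n
    Ball zero = setOf (λ x → x FP.≟ s)
    Ball (suc k) = setOf (λ x → x SP.∈? Ball k ⊎-dec (x SP.∈? Z ×-dec FP.any? (λ u → u SP.∈? Ball k ×-dec adj? u x)))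

    ball₀⁻ : ∀ {x} → x ∈ Ball 0 → x ≡ s
    ball₀⁻ = ∈setOf⁻ (λ x → x FP.≟ s)

    ball₀⁺ : s ∈ Ball 0
    ball₀⁺ = ∈setOf⁺ (λ x → x FP.≟ s) refl

    ballₛ⁻ : ∀ k {x} → x ∈ Ball (suc k) → x ∈ Ball k ⊎ (x ∈ Z × ∃ λ u → u ∈ Ball k × Adj G u x)
    ballₛ⁻ k = ∈setOf⁻ (λ x → x SP.∈? Ball k ⊎-dec (x SP.∈? Z ×-dec FP.any? (λ u → u SP.∈? Ball k ×-dec adj? u x)))

    ballₛ⁺ : ∀ k {x} → x ∈ Ball k ⊎ (x ∈ Z × ∃ λ u → u ∈ Ball k × Adj G u x) → x ∈ Ball (suc k)
    ballₛ⁺ k = ∈setOf⁺ (λ x → x SP.∈? Ball k ⊎-dec (x SP.∈? Z ×-dec FP.any? (λ u → u SP.∈? Ball k ×-dec adj? u x)))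

  ball-mono : ∀ {i j} → i ≤ j → Ball i ⊆ Ball j
  ball-mono {i} {j} i≤j with ℕP.m≤n⇒m<n∨m≡n i≤j
  ... | inj₂ refl = λ x∈ → x∈
  ball-mono {i} {suc j} _ | inj₁ (s≤s i≤j) = λ x∈ → ballₛ⁺ j (inj₁ (ball-mono i≤j x∈))

  centre∈ball : ∀ k → s ∈ Ball k
  centre∈ball k = ball-mono z≤n ball₀⁺

  ball⊆Z : ∀ k {x} → x ∈ Ball k → x ∈ Z
  ball⊆Z zero x∈ rewrite ball₀⁻ x∈ = s∈Z
  ball⊆Z (suc k) x∈ with ballₛ⁻ k x∈
  ... | inj₁ x∈′ = ball⊆Z k x∈′
  ... | inj₂ (x∈Z , _) = x∈Z

  Closed : (Fin n → Set) → Set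
  Closed B = ∀ x z → B x → z ∈ Z → Adj G x z → B z

  ball-least : (B : Fin n → Set) → B s → Closed B → ∀ k {x} → x ∈ Ball k → B x
  ball-least B Bs closed zero x∈ rewrite ball₀⁻ x∈ = Bs
  ball-least B Bs closed (suc k) x∈ with ballₛ⁻ k x∈
  ... | inj₁ x∈′ = ball-least B Bs closed k x∈′
  ... | inj₂ (x∈Z , u , u∈ , u~x) = closed u _ (ball-least B Bs closed k u∈) x∈Z u~x

  centre-reachable : (B : Fin n → Set) → Closed B → ∀ k {x} → x ∈ Ball k → B x → B s
  centre-reachable B closed zero x∈ Bx rewrite ball₀⁻ x∈ = Bx
  centre-reachable B closed (suc k) x∈ Bx with ballₛ⁻ k x∈
  ... | inj₁ x∈′ = centre-reachable B closed k x∈′ Bx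
  ... | inj₂ (_ , u , u∈ , u~x) = centre-reachable B closed k u∈ (closed _ u Bx (ball⊆Z k u∈) (Adj-sym u~x))

  -- Until the balls stop growing they gain a vertex per step, so Ball n is closed.
  private
    GrowsOrClosed : ℕ → Set
    GrowsOrClosed k = suc k ≤ ∣ Ball k ∣ ⊎ Closed (_∈ Ball k)

    closed-step : ∀ k → Closed (_∈ Ball k) → Closed (_∈ Ball (suc k))
    closed-step k closed x z x∈ z∈Z x~z = ballₛ⁺ k (inj₁ (closed x z (stationary x∈) z∈Z x~z))
      where
      stationary : ∀ {y} → y ∈ Ball (suc k) → y ∈ Ball k
      stationary y∈ with ballₛ⁻ k y∈
      ... | inj₁ y∈′ = y∈′
      ... | inj₂ (y∈Z , u , u∈ , u~y) = closed u _ u∈ y∈Z u~y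

    grows-or-closed : ∀ k → GrowsOrClosed k
    grows-or-closed zero = inj₁ (nonempty⇒positive ball₀⁺)
    grows-or-closed (suc k) with grows-or-closed k
    ... | inj₂ closed = inj₂ (closed-step k closed)
    ... | inj₁ big with Ball (suc k) SP.⊆? Ball k
    ...   | yes same = inj₂ (closed-step k (λ x z x∈ z∈Z x~z → same (ballₛ⁺ k (inj₂ (z∈Z , x , x∈ , x~z)))))
    ...   | no grew with ⊈⇒witness grew
    ...     | (x , x∈ , x∉) = inj₁ (ℕP.≤-trans (s≤s big) (proper⇒smaller (ball-mono (ℕP.n≤1+n k)) x∈ x∉))

  ball-closed : Closed (_∈ Ball n)
  ball-closed with grows-or-closed n
  ... | inj₂ closed = closed
  ... | inj₁ big = ⊥-elim (ℕP.<⇒≱ big (SP.∣p∣≤n (Ball n)))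

  Layer : ℕ → Fin n → Set
  Layer zero v = v ≡ s
  Layer (suc j) v = v ∈ Ball (suc j) × v ∉ Ball j

  layer⇒ball : ∀ j {v} → Layer j v → v ∈ Ball j
  layer⇒ball zero refl = ball₀⁺
  layer⇒ball (suc j) (v∈ , _) = v∈

  layer-of : ∀ k {v} → v ∈ Ball k → ∃ λ j → Layer j v
  layer-of zero v∈ = 0 , ball₀⁻ v∈
  layer-of (suc k) {v} v∈ with v SP.∈? Ball k
  ... | yes v∈′ = layer-of k v∈′
  ... | no v∉ = suc k , v∈ , v∉

  layer⇒∉lower-ball : ∀ i j {v} → i < j → Layer j v → v ∉ Ball i
  layer⇒∉lower-ball i (suc j) (s≤s i≤j) (_ , v∉) v∈ = v∉ (ball-mono i≤j v∈)

  layer-unique : ∀ i j {v} → Layer i v → Layer j v → i ≡ j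
  layer-unique i j Li Lj with ℕP.<-cmp i j
  ... | tri≈ _ i≡j _ = i≡j
  ... | tri< i<j _ _ = ⊥-elim (layer⇒∉lower-ball i j i<j Lj (layer⇒ball i Li))
  ... | tri> _ _ j<i = ⊥-elim (layer⇒∉lower-ball j i j<i Li (layer⇒ball j Lj))

  layer-predecessor : ∀ j {v} → Layer (suc j) v → ∃ λ u → Layer j u × Adj G u v
  layer-predecessor j (v∈ , v∉) with ballₛ⁻ j v∈
  ... | inj₁ v∈′ = ⊥-elim (v∉ v∈′)
  ... | inj₂ (v∈Z , u , u∈ , u~v) = u , exact j u∈ v∉ , u~v
    where
    exact : ∀ j → u ∈ Ball j → _ ∉ Ball j → Layer j u
    exact zero u∈ _ = ball₀⁻ u∈
    exact (suc j′) u∈ v∉′ = u∈ , λ u∈′ → v∉′ (ballₛ⁺ j′ (inj₂ (v∈Z , u , u∈′ , u~v)))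

  layers-far⇒¬Adj : ∀ i j {u v} → Layer i u → Layer j v → suc i < j → ¬ Adj G u v
  layers-far⇒¬Adj i (suc j) {u} {v} Lu (v∈ , v∉) (s≤s i+1≤j) u~v =
    v∉ (ball-mono i+1≤j (ballₛ⁺ i (inj₂ (ball⊆Z (suc j) v∈ , u , layer⇒ball i Lu , u~v))))

  record LayeredPath (j : ℕ) (v : Fin n) : Set where
    field
      vertex  : ℕ → Fin n
      ends    : vertex j ≡ v
      layered : ∀ i → i ≤ j → Layer i (vertex i)
      steps   : ∀ i → i < j → Adj G (vertex i) (vertex (suc i))

  layered-path : ∀ j v → Layer j v → LayeredPath j v
  layered-path zero v Lv = record
    { vertex = λ _ → v ; ends = refl ; layered = λ { zero z≤n → Lv } ; steps = λ i () }
  layered-path (suc j) v Lv with layer-predecessor j Lv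
  ... | u , Lu , u~v = record { vertex = vertex′ ; ends = ends′ ; layered = layered′ ; steps = steps′ }
    where
    open LayeredPath (layered-path j u Lu)
    vertex′ : ℕ → Fin n
    vertex′ i with i ℕP.≤? j
    ... | yes _ = vertex i
    ... | no _ = v
    ends′ : vertex′ (suc j) ≡ v
    ends′ with suc j ℕP.≤? j
    ... | yes j+1≤j = ⊥-elim (ℕP.1+n≰n j+1≤j)
    ... | no _ = refl
    layered′ : ∀ i → i ≤ suc j → Layer i (vertex′ i)
    layered′ i i≤ with i ℕP.≤? j
    ... | yes i≤j = layered i i≤j
    ... | no i≰j with ℕP.≤-antisym i≤ (ℕP.≰⇒> i≰j)
    ...   | refl = Lv
    steps′ : ∀ i → i < suc j → Adj G (vertex′ i) (vertex′ (suc i))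
    steps′ i (s≤s i≤j) with i ℕP.≤? j | suc i ℕP.≤? j
    ... | no i≰j | _ = ⊥-elim (i≰j i≤j)
    ... | yes _ | yes i+1≤j = steps i i+1≤j
    ... | yes _ | no i+1≰j with ℕP.≤-antisym i≤j (ℕP.≤-pred (ℕP.≰⇒> i+1≰j))
    ...   | refl rewrite ends = u~v

-- If t₁, t₂ are distinct and non-adjacent, then t₂ is not
-- reachable from t₁ in G[Z]: a layered (hence induced) t₁–t₂ path of length
-- m ≥ 2, closed up through a, would be an induced cycle of length m + 2 ≥ 4.
module NoDetour {n : ℕ} (G : Graph n) (chordal : Chordal G) (Z : Subset n) (t₁ t₂ a : Fin n) (t₁∈Z : t₁ ∈ Z)
    (a~t₁ : Adj G a t₁) (a~t₂ : Adj G a t₂) (a∉Z : a ∉ Z)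
    (a-sees-only : ∀ z → z ∈ Z → z ≢ t₁ → z ≢ t₂ → ¬ Adj G a z) where
  open GraphFacts G
  open BreadthFirst G Z t₁ t₁∈Z

  module Cycle (m′ : ℕ) (path : LayeredPath (suc (suc m′)) t₂) where
    open LayeredPath path

    m : ℕ
    m = suc (suc m′)

    cycle : Fin (suc (suc m)) → Fin n
    cycle fzero = a
    cycle (fsuc i) = vertex (toℕ i)

    on-path : ∀ i → i ≤ m → vertex i ∈ Z
    on-path i i≤m = ball⊆Z i (layer⇒ball i (layered i i≤m))

    index≤m : (i : Fin (suc m)) → toℕ i ≤ m
    index≤m = FP.toℕ≤pred[n]

    path-chords : ∀ i j → i ≤ m → j ≤ m → Adj G (vertex i) (vertex j) → suc i ≡ j ⊎ suc j ≡ i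
    path-chords i j i≤m j≤m e with ℕP.<-cmp i j
    ... | tri≈ _ refl _ = ⊥-elim (Adj-irrefl e)
    ... | tri< i<j _ _ with suc i ℕP.≟ j
    ...   | yes i+1≡j = inj₁ i+1≡j
    ...   | no i+1≢j = ⊥-elim (layers-far⇒¬Adj i j (layered i i≤m) (layered j j≤m) (ℕP.≤∧≢⇒< i<j i+1≢j) e)
    path-chords i j i≤m j≤m e | tri> _ _ j<i with suc j ℕP.≟ i
    ...   | yes j+1≡i = inj₂ j+1≡i
    ...   | no j+1≢i = ⊥-elim (layers-far⇒¬Adj j i (layered j j≤m) (layered i i≤m) (ℕP.≤∧≢⇒< j<i j+1≢i) (Adj-sym e))

    apex-chords : ∀ j → j ≤ m → Adj G a (vertex j) → j ≡ 0 ⊎ j ≡ m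
    apex-chords zero _ _ = inj₁ refl
    apex-chords (suc j) j+1≤m e with suc j ℕP.≟ m
    ... | yes j+1≡m = inj₂ j+1≡m
    ... | no j+1≢m = ⊥-elim (a-sees-only (vertex (suc j)) (on-path (suc j) j+1≤m) not-t₁ not-t₂ e)
      where
      Lj = layered (suc j) j+1≤m
      not-t₁ : vertex (suc j) ≢ t₁
      not-t₁ eq = ℕP.1+n≢0 (layer-unique (suc j) 0 Lj eq)
      not-t₂ : vertex (suc j) ≢ t₂
      not-t₂ eq = j+1≢m (layer-unique (suc j) m Lj (subst (Layer m) (trans ends (sym eq)) (layered m ℕP.≤-refl)))

    flip : ∀ {k} {i j : Fin k} → CycAdj G j i → CycAdj G i j
    flip (inj₁ next) = inj₂ next
    flip (inj₂ next) = inj₁ next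

    adjacent⇒consecutive : ∀ i j → Adj G (cycle i) (cycle j) → CycAdj G i j
    adjacent⇒consecutive fzero fzero e = ⊥-elim (Adj-irrefl e)
    adjacent⇒consecutive fzero (fsuc j) e with apex-chords (toℕ j) (index≤m j) e
    ... | inj₁ j≡0 = inj₁ (inj₁ (cong suc (sym j≡0)))
    ... | inj₂ j≡m = inj₂ (inj₂ (cong (λ x → suc (suc x)) j≡m , refl))
    adjacent⇒consecutive (fsuc i) fzero e = flip (adjacent⇒consecutive fzero (fsuc i) (Adj-sym e))
    adjacent⇒consecutive (fsuc i) (fsuc j) e with path-chords (toℕ i) (toℕ j) (index≤m i) (index≤m j) e
    ... | inj₁ eq = inj₁ (inj₁ (cong suc eq))
    ... | inj₂ eq = inj₂ (inj₁ (cong suc eq))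

    next⇒adjacent : ∀ i j → CycNext G i j → Adj G (cycle i) (cycle j)
    next⇒adjacent fzero fzero (inj₁ ())
    next⇒adjacent fzero fzero (inj₂ (() , _))
    next⇒adjacent fzero (fsuc j) (inj₁ eq) rewrite sym (ℕP.suc-injective eq) | layered 0 z≤n = a~t₁
    next⇒adjacent fzero (fsuc j) (inj₂ (_ , ()))
    next⇒adjacent (fsuc i) fzero (inj₁ ())
    next⇒adjacent (fsuc i) fzero (inj₂ (eq , _)) rewrite ℕP.suc-injective (ℕP.suc-injective eq) | ends = Adj-sym a~t₂
    next⇒adjacent (fsuc i) (fsuc j) (inj₁ eq) = subst (λ x → Adj G (vertex (toℕ i)) (vertex x)) (ℕP.suc-injective eq)
      (steps (toℕ i) (subst (_≤ m) (sym (ℕP.suc-injective eq)) (index≤m j)))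
    next⇒adjacent (fsuc i) (fsuc j) (inj₂ (_ , ()))

    injective : ∀ {i j} → cycle i ≡ cycle j → i ≡ j
    injective {fzero} {fzero} _ = refl
    injective {fzero} {fsuc j} eq = ⊥-elim (a∉Z (subst (_∈ Z) (sym eq) (on-path (toℕ j) (index≤m j))))
    injective {fsuc i} {fzero} eq = ⊥-elim (a∉Z (subst (_∈ Z) eq (on-path (toℕ i) (index≤m i))))
    injective {fsuc i} {fsuc j} eq = cong fsuc (FP.toℕ-injective
      (layer-unique (toℕ i) (toℕ j) (layered (toℕ i) (index≤m i))
        (subst (Layer (toℕ j)) (sym eq) (layered (toℕ j) (index≤m j)))))

    induced : IsInducedCycle G (suc (suc m)) cycle
    induced = injective , λ i j → mk⇔ (adjacent⇒consecutive i j)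
      [ next⇒adjacent i j , (λ next → Adj-sym (next⇒adjacent j i next)) ]′

  no-detour : ∀ k → t₂ ∈ Ball k → t₁ ≢ t₂ → ¬ Adj G t₁ t₂ → ⊥
  no-detour k t₂∈ t₁≢t₂ t₁≁t₂ with layer-of k t₂∈
  ... | zero , t₂≡t₁ = t₁≢t₂ (sym t₂≡t₁)
  ... | suc zero , L₁ with layer-predecessor 0 L₁
  ...   | _ , refl , t₁~t₂ = t₁≁t₂ t₁~t₂
  no-detour k t₂∈ t₁≢t₂ t₁≁t₂ | suc (suc m′) , L =
    chordal (4 + m′) (s≤s (s≤s (s≤s (s≤s z≤n)))) cycle induced
    where open Cycle m′ (layered-path (suc (suc m′)) t₂ L)

module LeafCliques {n : ℕ} (G : Graph n) (chordal : Chordal G) where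
  open Subsets {n}
  open GraphFacts G

  -- A leaf of a clique tree of G[S] rooted at the clique C: a maximal clique K
  -- of G[S] and the clique P it hangs from.
  record LeafClique (S C : Subset n) : Set where
    field
      K P           : Subset n
      K⊆S           : K ⊆ S
      K-clique      : IsClique G K
      K-maximal     : ∀ y → y ∈ S → Complete y K → y ∈ K
      P⊆S           : P ⊆ S
      P-clique      : IsClique G P
      P-root-or-⊈K  : ¬ (P ⊆ K) ⊎ P ≡ C
      exclusive     : ∀ x → x ∈ K → x ∈ P ⊎ (x ∉ C × (∀ y → y ∈ S → Adj G x y → y ∈ K))
      w₀            : Fin n
      w₀∈K          : w₀ ∈ K
      w₀∉P          : w₀ ∉ P

  HasLeaves : ℕ → Set
  HasLeaves f = ∀ S C → ∣ S ∣ ≤ f → C ⊆ S → IsClique G C → ∀ s → s ∈ S → s ∉ C → LeafClique S C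

  -- The structure around a vertex a ∈ S with a non-neighbour x₀ ∈ S: the
  -- component X of x₀ in S minus the closed neighbourhood of a, and the set T
  -- of neighbours of a in S that see X.  Chordality makes T a clique.
  module Separator (S : Subset n) (a x₀ : Fin n) (x₀∈S : x₀ ∈ S) (x₀≢a : x₀ ≢ a) (a≁x₀ : ¬ Adj G a x₀) where
    Far : Fin n → Set
    Far x = x ∈ S × x ≢ a × ¬ Adj G a x

    far? : Decidable Far
    far? x = x SP.∈? S ×-dec ¬? (x FP.≟ a) ×-dec ¬? (adj? a x)

    x₀∈Far : x₀ ∈ setOf far?
    x₀∈Far = ∈setOf⁺ far? (x₀∈S , x₀≢a , a≁x₀)

    module Component = BreadthFirst G (setOf far?) x₀ x₀∈Far

    X : Subset n
    X = Component.Ball n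

    X-far : ∀ {x} → x ∈ X → Far x
    X-far x∈X = ∈setOf⁻ far? (Component.ball⊆Z n x∈X)

    X-closed : ∀ x z → x ∈ X → Far z → Adj G x z → z ∈ X
    X-closed x z x∈X z-far x~z = Component.ball-closed x z x∈X (∈setOf⁺ far? z-far) x~z

    x₀∈X : x₀ ∈ X
    x₀∈X = Component.centre∈ball n

    Attached : Fin n → Set
    Attached t = t ∈ S × Adj G a t × ∃ λ x → x ∈ X × Adj G t x

    attached? : Decidable Attached
    attached? t = t SP.∈? S ×-dec adj? a t ×-dec FP.any? (λ x → x SP.∈? X ×-dec adj? t x)

    T : Subset n
    T = setOf attached?

    T-attached : ∀ {t} → t ∈ T → Attached t
    T-attached = ∈setOf⁻ attached?

    X-neighbour : ∀ {x y} → x ∈ X → y ∈ S → Adj G x y → y ∈ X ⊎ y ∈ T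
    X-neighbour {x} {y} x∈X y∈S x~y with adj? a y
    ... | yes a~y = inj₂ (∈setOf⁺ attached? (y∈S , a~y , x , x∈X , Adj-sym x~y))
    ... | no a≁y with y FP.≟ a
    ...   | yes refl = ⊥-elim (proj₂ (proj₂ (X-far x∈X)) (Adj-sym x~y))
    ...   | no y≢a = inj₁ (X-closed x y x∈X (y∈S , y≢a , a≁y) x~y)

    -- Two non-adjacent t₁, t₂ ∈ T would be joined through X, and a would close
    -- an induced cycle of length ≥ 4.
    T-clique : IsClique G T
    T-clique t₁ t₂ t₁∈T t₂∈T t₁≢t₂ with adj? t₁ t₂
    ... | yes t₁~t₂ = t₁~t₂
    ... | no t₁≁t₂ = ⊥-elim (NoDetour.no-detour G chordal Z t₁ t₂ a t₁∈Z a~t₁ a~t₂ a∉Z a-sees-only n t₂∈D t₁≢t₂ t₁≁t₂)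
      where
      Z : Subset n
      Z = (X ∪ ⁅ t₁ ⁆) ∪ ⁅ t₂ ⁆
      X⊆Z : X ⊆ Z
      X⊆Z x∈X = SP.x∈p∪q⁺ (inj₁ (SP.x∈p∪q⁺ (inj₁ x∈X)))
      t₁∈Z : t₁ ∈ Z
      t₁∈Z = SP.x∈p∪q⁺ (inj₁ (SP.x∈p∪q⁺ (inj₂ (SP.x∈⁅x⁆ t₁))))
      t₂∈Z : t₂ ∈ Z
      t₂∈Z = SP.x∈p∪q⁺ (inj₂ (SP.x∈⁅x⁆ t₂))
      a~t₁ = proj₁ (proj₂ (T-attached t₁∈T))
      a~t₂ = proj₁ (proj₂ (T-attached t₂∈T))
      a∉Z : a ∉ Z
      a∉Z a∈Z with ∈p∪⁅x⁆⁻ a∈Z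
      ... | inj₂ a≡t₂ = Adj⇒≢ a~t₂ a≡t₂
      ... | inj₁ a∈ with ∈p∪⁅x⁆⁻ a∈
      ...   | inj₁ a∈X = proj₁ (proj₂ (X-far a∈X)) refl
      ...   | inj₂ a≡t₁ = Adj⇒≢ a~t₁ a≡t₁
      a-sees-only : ∀ z → z ∈ Z → z ≢ t₁ → z ≢ t₂ → ¬ Adj G a z
      a-sees-only z z∈Z z≢t₁ z≢t₂ with ∈p∪⁅x⁆⁻ z∈Z
      ... | inj₂ z≡t₂ = ⊥-elim (z≢t₂ z≡t₂)
      ... | inj₁ z∈ with ∈p∪⁅x⁆⁻ z∈
      ...   | inj₁ z∈X = proj₂ (proj₂ (X-far z∈X))
      ...   | inj₂ z≡t₁ = ⊥-elim (z≢t₁ z≡t₁)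
      module Reach = BreadthFirst G Z t₁ t₁∈Z
      D : Subset n
      D = Reach.Ball n
      -- X ∩ D is closed within the far vertices, and meets X (near t₁) …
      InXD : Fin n → Set
      InXD x = x ∈ X × x ∈ D
      XD-closed : Component.Closed InXD
      XD-closed x z (x∈X , x∈D) z∈Far x~z =
        z∈X , Reach.ball-closed x z x∈D (X⊆Z z∈X) x~z
        where
        z∈X = X-closed x z x∈X (∈setOf⁻ far? z∈Far) x~z
      x₁ = proj₁ (proj₂ (proj₂ (T-attached t₁∈T)))
      x₁∈X = proj₁ (proj₂ (proj₂ (proj₂ (T-attached t₁∈T))))
      t₁~x₁ = proj₂ (proj₂ (proj₂ (proj₂ (T-attached t₁∈T))))
      x₁∈D : x₁ ∈ D
      x₁∈D = Reach.ball-closed t₁ x₁ (Reach.centre∈ball n) (X⊆Z x₁∈X) t₁~x₁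
      -- … hence contains x₀ and then all of X, so t₂ is reachable from t₁.
      X⊆D : ∀ {x} → x ∈ X → x ∈ D
      X⊆D x∈X = proj₂ (Component.ball-least InXD x₀∈XD XD-closed n x∈X)
        where
        x₀∈XD = Component.centre-reachable InXD XD-closed n x₁∈X (x₁∈X , x₁∈D)
      x₂ = proj₁ (proj₂ (proj₂ (T-attached t₂∈T)))
      x₂∈X = proj₁ (proj₂ (proj₂ (proj₂ (T-attached t₂∈T))))
      t₂~x₂ = proj₂ (proj₂ (proj₂ (proj₂ (T-attached t₂∈T))))
      t₂∈D : t₂ ∈ D
      t₂∈D = Reach.ball-closed x₂ t₂ (X⊆D x₂∈X) t₂∈Z (Adj-sym t₂~x₂)

  -- If a ∈ S sees all of C but misses x₀ ∈ S, a leaf is found by induction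
  -- inside X ∪ T, relative to the clique T; if that leaf hangs from T itself,
  -- then in G[S] it hangs from T ∪ {a}.
  separator-leaf : ∀ f → HasLeaves f → ∀ S C → ∣ S ∣ ≤ suc f → C ⊆ S → IsClique G C →
                   ∀ a x₀ → a ∈ S → x₀ ∈ S → x₀ ≢ a → ¬ Adj G a x₀ →
                   (∀ c → c ∈ C → c ≡ a ⊎ Adj G a c) → LeafClique S C
  separator-leaf f leaves S C |S|≤ C⊆S C-clique a x₀ a∈S x₀∈S x₀≢a a≁x₀ C-near-a = result L₁.P-root-or-⊈K
    where
    open Separator S a x₀ x₀∈S x₀≢a a≁x₀
    S₁ : Subset n
    S₁ = X ∪ T
    S₁⊆S : S₁ ⊆ S
    S₁⊆S x∈ = [ (λ x∈X → proj₁ (X-far x∈X)) , (λ x∈T → proj₁ (T-attached x∈T)) ]′ (SP.x∈p∪q⁻ X T x∈)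
    a∉S₁ : a ∉ S₁
    a∉S₁ a∈ = [ (λ a∈X → proj₁ (proj₂ (X-far a∈X)) refl) , (λ a∈T → Adj-irrefl (proj₁ (proj₂ (T-attached a∈T)))) ]′
                (SP.x∈p∪q⁻ X T a∈)
    L₁ : LeafClique S₁ T
    L₁ = leaves S₁ T (ℕP.≤-pred (ℕP.≤-trans (proper⇒smaller S₁⊆S a∈S a∉S₁) |S|≤)) (SP.q⊆p∪q X T) T-clique
                x₀ (SP.p⊆p∪q T x₀∈X) (λ x₀∈T → a≁x₀ (proj₁ (proj₂ (T-attached x₀∈T))))
    module L₁ = LeafClique L₁
    outside-T⇒∈X : ∀ {x} → x ∈ L₁.K → x ∉ T → x ∈ X
    outside-T⇒∈X x∈K x∉T = [ (λ x∈X → x∈X) , (λ x∈T → ⊥-elim (x∉T x∈T)) ]′ (SP.x∈p∪q⁻ X T (L₁.K⊆S x∈K))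
    w₀∈X : L₁.w₀ ∈ X
    w₀∈X with L₁.exclusive L₁.w₀ L₁.w₀∈K
    ... | inj₁ w₀∈P = ⊥-elim (L₁.w₀∉P w₀∈P)
    ... | inj₂ (w₀∉T , _) = outside-T⇒∈X L₁.w₀∈K w₀∉T
    -- a vertex complete to K₁ sees w₀ ∈ X, so it already lies in S₁
    K-maximal : ∀ y → y ∈ S → Complete y L₁.K → y ∈ L₁.K
    K-maximal y y∈S complete =
      L₁.K-maximal y (SP.x∈p∪q⁺ (X-neighbour w₀∈X y∈S (complete L₁.w₀ L₁.w₀∈K))) complete
    -- vertices exclusive to K₁ in G[S₁] lie in X, hence are exclusive in G[S]
    still-exclusive : ∀ x → x ∈ L₁.K → x ∉ T × (∀ y → y ∈ S₁ → Adj G x y → y ∈ L₁.K) →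
                      x ∉ C × (∀ y → y ∈ S → Adj G x y → y ∈ L₁.K)
    still-exclusive x x∈K (x∉T , nbrs) =
      x∉C , λ y y∈S x~y → nbrs y (SP.x∈p∪q⁺ (X-neighbour x∈X y∈S x~y)) x~y
      where
      x∈X = outside-T⇒∈X x∈K x∉T
      x∉C : x ∉ C
      x∉C x∈C = [ proj₁ (proj₂ (X-far x∈X)) , proj₂ (proj₂ (X-far x∈X)) ]′ (C-near-a x x∈C)
    P-from-T : L₁.P ≡ T → LeafClique S C
    P-from-T P≡T = record
      { K = L₁.K ; P = P ; K⊆S = λ x∈ → S₁⊆S (L₁.K⊆S x∈) ; K-clique = L₁.K-clique ; K-maximal = K-maximal
      ; P⊆S = P⊆S ; P-clique = P-clique ; P-root-or-⊈K = inj₁ (λ P⊆K → a∉S₁ (L₁.K⊆S (P⊆K x∈p∪⁅x⁆)))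
      ; exclusive = λ x x∈K → Data.Sum.map (λ x∈P₁ → p⊆p∪⁅x⁆ (subst (x ∈_) P≡T x∈P₁)) (still-exclusive x x∈K)
                                           (L₁.exclusive x x∈K)
      ; w₀ = L₁.w₀ ; w₀∈K = L₁.w₀∈K ; w₀∉P = w₀∉P }
      where
      P : Subset n
      P = T ∪ ⁅ a ⁆
      P⊆S : P ⊆ S
      P⊆S x∈ = [ (λ x∈T → proj₁ (T-attached x∈T)) , (λ { refl → a∈S }) ]′ (∈p∪⁅x⁆⁻ x∈)
      P-clique : IsClique G P
      P-clique u v u∈ v∈ u≢v with ∈p∪⁅x⁆⁻ u∈ | ∈p∪⁅x⁆⁻ v∈
      ... | inj₁ u∈T | inj₁ v∈T = T-clique u v u∈T v∈T u≢v
      ... | inj₁ u∈T | inj₂ refl = Adj-sym (proj₁ (proj₂ (T-attached u∈T)))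
      ... | inj₂ refl | inj₁ v∈T = proj₁ (proj₂ (T-attached v∈T))
      ... | inj₂ refl | inj₂ refl = ⊥-elim (u≢v refl)
      w₀∉P : L₁.w₀ ∉ P
      w₀∉P w₀∈ = [ (λ w₀∈T → L₁.w₀∉P (subst (L₁.w₀ ∈_) (sym P≡T) w₀∈T))
                 , (λ w₀≡a → a∉S₁ (subst (_∈ S₁) w₀≡a (L₁.K⊆S L₁.w₀∈K))) ]′ (∈p∪⁅x⁆⁻ w₀∈)
    result : ¬ (L₁.P ⊆ L₁.K) ⊎ L₁.P ≡ T → LeafClique S C
    result (inj₂ P≡T) = P-from-T P≡T
    result (inj₁ P⊈K) = record
      { K = L₁.K ; P = L₁.P ; K⊆S = λ x∈ → S₁⊆S (L₁.K⊆S x∈) ; K-clique = L₁.K-clique ; K-maximal = K-maximal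
      ; P⊆S = λ x∈ → S₁⊆S (L₁.P⊆S x∈) ; P-clique = L₁.P-clique ; P-root-or-⊈K = inj₁ P⊈K
      ; exclusive = λ x x∈K → Data.Sum.map (λ x∈P → x∈P) (still-exclusive x x∈K) (L₁.exclusive x x∈K)
      ; w₀ = L₁.w₀ ; w₀∈K = L₁.w₀∈K ; w₀∉P = L₁.w₀∉P }

  -- If a ∈ C is adjacent to every other vertex of S, a leaf of G[S − a]
  -- relative to C − a extends by a.
  universal-leaf : ∀ f → HasLeaves f → ∀ S C → ∣ S ∣ ≤ suc f → C ⊆ S → IsClique G C → ∀ s → s ∈ S → s ∉ C →
                   ∀ a → a ∈ C → (∀ y → y ∈ S → y ≢ a → Adj G a y) → LeafClique S C
  universal-leaf f leaves S C |S|≤ C⊆S C-clique s s∈S s∉C a a∈C universal = record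
    { K = K ; P = P ; K⊆S = ⊆S L′.K⊆S ; K-clique = with-a-clique L′.K⊆S L′.K-clique ; K-maximal = K-maximal
    ; P⊆S = ⊆S L′.P⊆S ; P-clique = with-a-clique L′.P⊆S L′.P-clique ; P-root-or-⊈K = P-root-or-⊈K L′.P-root-or-⊈K
    ; exclusive = exclusive ; w₀ = L′.w₀ ; w₀∈K = p⊆p∪⁅x⁆ L′.w₀∈K ; w₀∉P = w₀∉P }
    where
    a∈S = C⊆S a∈C
    s≢a : s ≢ a
    s≢a refl = s∉C a∈C
    L′ : LeafClique (S - a) (C - a)
    L′ = leaves (S - a) (C - a) (ℕP.≤-pred (ℕP.≤-trans (SP.x∈p⇒∣p-x∣<∣p∣ a∈S) |S|≤))
                (λ x∈ → SP.x∈p∧x≢y⇒x∈p-y (C⊆S (proj₁ (∈p-y⁻ x∈))) (proj₂ (∈p-y⁻ x∈)))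
                (clique-⊆ (SP.p─q⊆p C ⁅ a ⁆) C-clique)
                s (SP.x∈p∧x≢y⇒x∈p-y s∈S s≢a) (λ s∈ → s∉C (proj₁ (∈p-y⁻ s∈)))
    module L′ = LeafClique L′
    K P : Subset n
    K = L′.K ∪ ⁅ a ⁆
    P = L′.P ∪ ⁅ a ⁆
    ⊆S : ∀ {M} → M ⊆ S - a → M ∪ ⁅ a ⁆ ⊆ S
    ⊆S M⊆ x∈ = [ (λ x∈M → proj₁ (∈p-y⁻ (M⊆ x∈M))) , (λ { refl → a∈S }) ]′ (∈p∪⁅x⁆⁻ x∈)
    with-a-clique : ∀ {M} → M ⊆ S - a → IsClique G M → IsClique G (M ∪ ⁅ a ⁆)
    with-a-clique {M} M⊆ M-clique u v u∈ v∈ u≢v with ∈p∪⁅x⁆⁻ u∈ | ∈p∪⁅x⁆⁻ v∈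
    ... | inj₁ u∈M | inj₁ v∈M = M-clique u v u∈M v∈M u≢v
    ... | inj₁ u∈M | inj₂ refl = Adj-sym (universal u (proj₁ (∈p-y⁻ (M⊆ u∈M))) (proj₂ (∈p-y⁻ (M⊆ u∈M))))
    ... | inj₂ refl | inj₁ v∈M = universal v (proj₁ (∈p-y⁻ (M⊆ v∈M))) (proj₂ (∈p-y⁻ (M⊆ v∈M)))
    ... | inj₂ refl | inj₂ refl = ⊥-elim (u≢v refl)
    K-maximal : ∀ y → y ∈ S → Complete y K → y ∈ K
    K-maximal y y∈S complete = p⊆p∪⁅x⁆ (L′.K-maximal y (SP.x∈p∧x≢y⇒x∈p-y y∈S y≢a) (λ m m∈ → complete m (p⊆p∪⁅x⁆ m∈)))
      where
      y≢a : y ≢ a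
      y≢a refl = Adj-irrefl (complete a x∈p∪⁅x⁆)
    P-root-or-⊈K : ¬ (L′.P ⊆ L′.K) ⊎ L′.P ≡ C - a → ¬ (P ⊆ K) ⊎ P ≡ C
    P-root-or-⊈K (inj₁ P′⊈K′) = inj₁ λ P⊆K → P′⊈K′ λ {p} p∈P′ →
      [ (λ p∈K′ → p∈K′) , (λ p≡a → ⊥-elim (proj₂ (∈p-y⁻ (L′.P⊆S p∈P′)) p≡a)) ]′ (∈p∪⁅x⁆⁻ (P⊆K (p⊆p∪⁅x⁆ p∈P′)))
    P-root-or-⊈K (inj₂ P′≡C-a) = inj₂ (SP.⊆-antisym P⊆C C⊆P)
      where
      P⊆C : P ⊆ C
      P⊆C {x} x∈ = [ (λ x∈P′ → proj₁ (∈p-y⁻ (subst (x ∈_) P′≡C-a x∈P′))) , (λ { refl → a∈C }) ]′ (∈p∪⁅x⁆⁻ x∈)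
      C⊆P : C ⊆ P
      C⊆P {x} x∈C with x FP.≟ a
      ... | yes refl = x∈p∪⁅x⁆
      ... | no x≢a = p⊆p∪⁅x⁆ (subst (x ∈_) (sym P′≡C-a) (SP.x∈p∧x≢y⇒x∈p-y x∈C x≢a))
    exclusive : ∀ x → x ∈ K → x ∈ P ⊎ (x ∉ C × (∀ y → y ∈ S → Adj G x y → y ∈ K))
    exclusive x x∈ with ∈p∪⁅x⁆⁻ x∈
    ... | inj₂ refl = inj₁ x∈p∪⁅x⁆
    ... | inj₁ x∈K′ with L′.exclusive x x∈K′
    ...   | inj₁ x∈P′ = inj₁ (p⊆p∪⁅x⁆ x∈P′)
    ...   | inj₂ (x∉C-a , nbrs) = inj₂ (x∉C , nbrs′)
      where
      x≢a = proj₂ (∈p-y⁻ (L′.K⊆S x∈K′))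
      x∉C : x ∉ C
      x∉C x∈C = x∉C-a (SP.x∈p∧x≢y⇒x∈p-y x∈C x≢a)
      nbrs′ : ∀ y → y ∈ S → Adj G x y → y ∈ K
      nbrs′ y y∈S x~y with y FP.≟ a
      ... | yes refl = x∈p∪⁅x⁆
      ... | no y≢a = p⊆p∪⁅x⁆ (nbrs y (SP.x∈p∧x≢y⇒x∈p-y y∈S y≢a) x~y)
    w₀∉P : L′.w₀ ∉ P
    w₀∉P w₀∈ = [ L′.w₀∉P , proj₂ (∈p-y⁻ (L′.K⊆S L′.w₀∈K)) ]′ (∈p∪⁅x⁆⁻ w₀∈)

  clique-leaf : ∀ S C → C ⊆ S → IsClique G C → IsClique G S → ∀ s → s ∈ S → s ∉ C → LeafClique S C
  clique-leaf S C C⊆S C-clique S-clique s s∈S s∉C = record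
    { K = S ; P = C ; K⊆S = λ x∈ → x∈ ; K-clique = S-clique ; K-maximal = λ y y∈S _ → y∈S
    ; P⊆S = C⊆S ; P-clique = C-clique ; P-root-or-⊈K = inj₂ refl
    ; exclusive = exclusive ; w₀ = s ; w₀∈K = s∈S ; w₀∉P = s∉C }
    where
    exclusive : ∀ x → x ∈ S → x ∈ C ⊎ (x ∉ C × (∀ y → y ∈ S → Adj G x y → y ∈ S))
    exclusive x x∈S with x SP.∈? C
    ... | yes x∈C = inj₁ x∈C
    ... | no x∉C = inj₂ (x∉C , λ y y∈S _ → y∈S)

  data LeafCase (S C : Subset n) : Set where
    clique    : IsClique G S → LeafCase S C
    universal : ∀ a → a ∈ C → (∀ y → y ∈ S → y ≢ a → Adj G a y) → LeafCase S C
    separated : ∀ a x₀ → a ∈ S → x₀ ∈ S → x₀ ≢ a → ¬ Adj G a x₀ → (∀ c → c ∈ C → c ≡ a ⊎ Adj G a c) → LeafCase S C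

  leaf-case : ∀ S C → C ⊆ S → IsClique G C → LeafCase S C
  leaf-case S C C⊆S C-clique with FP.any? (λ a → FP.any? (λ y → a SP.∈? S ×-dec y SP.∈? S ×-dec ¬? (a FP.≟ y) ×-dec ¬? (adj? a y)))
  ... | no no-non-edge = clique S-clique
    where
    S-clique : IsClique G S
    S-clique u v u∈S v∈S u≢v with adj? u v
    ... | yes u~v = u~v
    ... | no u≁v = ⊥-elim (no-non-edge (u , v , u∈S , v∈S , u≢v , u≁v))
  ... | yes (a₀ , y₀ , a₀∈S , y₀∈S , a₀≢y₀ , a₀≁y₀)
    with FP.any? (λ a → a SP.∈? C ×-dec FP.all? (λ y → y SP.∈? S →-dec (¬? (y FP.≟ a) →-dec adj? a y)))
  ... | yes (a , a∈C , a-universal) = universal a a∈C a-universal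
  ... | no no-universal with FP.any? (λ c → c SP.∈? C)
  ...   | no C-empty = separated a₀ y₀ a₀∈S y₀∈S (λ e → a₀≢y₀ (sym e)) a₀≁y₀ (λ c c∈C → ⊥-elim (C-empty (c , c∈C)))
  ...   | yes (c , c∈C) with FP.any? (λ y → y SP.∈? S ×-dec ¬? (y FP.≟ c) ×-dec ¬? (adj? c y))
  ...     | yes (y , y∈S , y≢c , c≁y) = separated c y (C⊆S c∈C) y∈S y≢c c≁y C-near-c
    where
    C-near-c : ∀ d → d ∈ C → d ≡ c ⊎ Adj G c d
    C-near-c d d∈C with d FP.≟ c
    ... | yes d≡c = inj₁ d≡c
    ... | no d≢c = inj₂ (C-clique c d c∈C d∈C (λ e → d≢c (sym e)))
  ...     | no no-non-neighbour = ⊥-elim (no-universal (c , c∈C , c-universal))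
    where
    c-universal : ∀ y → y ∈ S → y ≢ c → Adj G c y
    c-universal y y∈S y≢c with adj? c y
    ... | yes c~y = c~y
    ... | no c≁y = ⊥-elim (no-non-neighbour (y , y∈S , y≢c , c≁y))

  leaf-clique : ∀ f → HasLeaves f
  leaf-clique zero S C |S|≤0 C⊆S C-clique s s∈S s∉C = ⊥-elim (ℕP.<⇒≱ (nonempty⇒positive s∈S) |S|≤0)
  leaf-clique (suc f) S C |S|≤ C⊆S C-clique s s∈S s∉C with leaf-case S C C⊆S C-clique
  ... | clique S-clique = clique-leaf S C C⊆S C-clique S-clique s s∈S s∉C
  ... | universal a a∈C a-universal = universal-leaf f (leaf-clique f) S C |S|≤ C⊆S C-clique s s∈S s∉C a a∈C a-universal
  ... | separated a x₀ a∈S x₀∈S x₀≢a a≁x₀ C-near-a =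
    separator-leaf f (leaf-clique f) S C |S|≤ C⊆S C-clique a x₀ a∈S x₀∈S x₀≢a a≁x₀ C-near-a

snoc : ∀ {A : Set} {k} → (Fin k → A) → A → Fin (suc k) → A
snoc {k = zero} f a _ = a
snoc {k = suc k} f a fzero = f fzero
snoc {k = suc k} f a (fsuc i) = snoc (λ j → f (fsuc j)) a i

snoc-inject₁ : ∀ {A : Set} {k} (f : Fin k → A) a (i : Fin k) → snoc f a (inject₁ i) ≡ f i
snoc-inject₁ {k = suc k} f a fzero = refl
snoc-inject₁ {k = suc k} f a (fsuc i) = snoc-inject₁ (λ j → f (fsuc j)) a i

snoc-last : ∀ {A : Set} {k} (f : Fin k → A) a → snoc f a (fromℕ k) ≡ a
snoc-last {k = zero} f a = refl
snoc-last {k = suc k} f a = snoc-last (λ j → f (fsuc j)) a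

old-or-last : ∀ {k} (i : Fin (suc k)) → (∃ λ j → i ≡ inject₁ j) ⊎ i ≡ fromℕ k
old-or-last {zero} fzero = inj₂ refl
old-or-last {suc k} fzero = inj₁ (fzero , refl)
old-or-last {suc k} (fsuc i) with old-or-last i
... | inj₁ (j , refl) = inj₁ (fsuc j , refl)
... | inj₂ refl = inj₂ refl

module NewLeaf (R : RootedTree) (p : RootedTree.Node R) where
  open RootedTree R

  parent′ : Fin (suc m) → Fin (suc (suc m))
  parent′ = snoc (λ i → inject₁ (parent i)) (inject₁ p)

  parent′-old : ∀ i → parent′ (inject₁ i) ≡ inject₁ (parent i)
  parent′-old = snoc-inject₁ (λ i → inject₁ (parent i)) (inject₁ p)

  parent′-new : parent′ (fromℕ m) ≡ inject₁ p
  parent′-new = snoc-last (λ i → inject₁ (parent i)) (inject₁ p)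

  grown : RootedTree
  grown = record { m = suc m ; parent = parent′ ; parent-lt = parent′-lt }
    where
    parent′-lt : ∀ i → toℕ (parent′ i) ≤ toℕ i
    parent′-lt i with old-or-last i
    ... | inj₁ (j , refl) rewrite parent′-old j | FP.toℕ-inject₁ (parent j) | FP.toℕ-inject₁ j = parent-lt j
    ... | inj₂ refl rewrite parent′-new | FP.toℕ-inject₁ p | FP.toℕ-fromℕ m = FP.toℕ≤pred[n] p

  module Grown = RootedTree grown

  new : Grown.Node
  new = fromℕ (suc m)

  lift-adj : ∀ {a b} → TAdj a b → Grown.TAdj (inject₁ a) (inject₁ b)
  lift-adj (i , inj₁ (refl , refl)) = inject₁ i , inj₁ (refl , sym (parent′-old i))
  lift-adj (i , inj₂ (refl , refl)) = inject₁ i , inj₂ (refl , sym (parent′-old i))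

  lift-path : (P : Node → Set) (P′ : Grown.Node → Set) → (∀ a → P a → P′ (inject₁ a)) →
              ∀ {a b} → PathIn P a b → Grown.PathIn P′ (inject₁ a) (inject₁ b)
  lift-path P P′ P⇒P′ (here Pa) = Grown.here (P⇒P′ _ Pa)
  lift-path P P′ P⇒P′ (step Pa a-b rest) = Grown.step (P⇒P′ _ Pa) (lift-adj a-b) (lift-path P P′ P⇒P′ rest)

  new-p : Grown.TAdj new (inject₁ p)
  new-p = fromℕ m , inj₁ (refl , sym parent′-new)

  p-new : Grown.TAdj (inject₁ p) new
  p-new = fromℕ m , inj₂ (refl , sym parent′-new)

  append-step : ∀ {P : Grown.Node → Set} {a b c} → Grown.PathIn P a b → Grown.TAdj b c → P c → Grown.PathIn P a c
  append-step (Grown.here Pa) b-c Pc = Grown.step Pa b-c (Grown.here Pc)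
  append-step (Grown.step Pa a-b rest) b-c Pc = Grown.step Pa a-b (append-step rest b-c Pc)

module BagConditions {n : ℕ} (G : Graph n) where
  open GraphFacts G

  Admissible : Subset n → Set
  Admissible B = 3 ≤ ∣ B ∣ × (∣ B ∣ ≡ 3 → IsMaximalClique G B)

  SharesAllButOne : Subset n → Subset n → Set
  SharesAllButOne B B′ = 5 ≤ ∣ B ∣ → ∣ B ∩ B′ ∣ ≡ ∣ B ∣ ∸ 1

  Good : Subset n → Set
  Good M = 4 ≤ ∣ M ∣ ⊎ IsMaximal3Clique G M

  good⇒admissible : ∀ {M} → Good M → Admissible M
  good⇒admissible (inj₁ 4≤) = ℕP.≤-trans (ℕP.n≤1+n 3) 4≤ , λ ∣M∣≡3 → ⊥-elim (ℕP.<⇒≢ 4≤ (sym ∣M∣≡3))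
  good⇒admissible (inj₂ (maximal , ∣M∣≡3)) = ℕP.≤-reflexive (sym ∣M∣≡3) , λ _ → maximal

  AllGood : Subset n → Set
  AllGood S = ∀ M → M ⊆ S → IsClique G M → (∀ y → y ∈ S → Complete y M → y ∈ M) → Good M

module CliqueTrees {n : ℕ} (G : Graph n) (C : Subset n) where
  open BagConditions G public


  record CliqueTree : Set where
    field
      tree : RootedTree
    open RootedTree tree public
    field
      bag        : Node → Subset n
      bag-clique : ∀ u → IsClique G (bag u)
      root-bag   : bag root ≡ C
      subtree    : ∀ v → InducesSubtree (λ u → v ∈ bag u)
      distinct   : ∀ i → bag (fsuc i) ≢ bag (parent i)
      admissible : ∀ u → Admissible (bag u)
      shares     : ∀ i → SharesAllButOne (bag (fsuc i)) (bag (parent i))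

  root-only : IsClique G C → Admissible C → CliqueTree
  root-only C-clique C-admissible = record
    { tree = trivial ; bag = λ _ → C ; bag-clique = λ _ → C-clique ; root-bag = refl ; subtree = single
    ; distinct = λ () ; admissible = λ _ → C-admissible ; shares = λ () }
    where
    trivial : RootedTree
    trivial = record { m = 0 ; parent = λ () ; parent-lt = λ () }
    single : ∀ v → RootedTree.InducesSubtree trivial (λ u → v ∈ C)
    single v fzero fzero v∈C _ = RootedTree.here v∈C

  record Extension (T : CliqueTree) (B : Subset n) : Set where
    field
      T′    : CliqueTree
      keeps : ∀ u → ∃ λ u′ → CliqueTree.bag T′ u′ ≡ CliqueTree.bag T u
      adds  : ∃ λ ν → CliqueTree.bag T′ ν ≡ B
      only  : ∀ u′ → (∃ λ u → CliqueTree.bag T′ u′ ≡ CliqueTree.bag T u) ⊎ CliqueTree.bag T′ u′ ≡ B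

  -- A clique B may hang below p if every vertex of B already used in T lies
  -- in the bag of p (so the subtree property survives), and B satisfies the
  -- niceness conditions relative to that bag.
  add-leaf : (T : CliqueTree) (p : CliqueTree.Node T) (B : Subset n) → IsClique G B →
             (∀ v → v ∈ B → (∃ λ u → v ∈ CliqueTree.bag T u) → v ∈ CliqueTree.bag T p) →
             B ≢ CliqueTree.bag T p → Admissible B → SharesAllButOne B (CliqueTree.bag T p) → Extension T B
  add-leaf T p B B-clique B-used⊆p B≢p B-admissible B-shares = record
    { T′ = T′ ; keeps = λ u → inject₁ u , bag′-old u ; adds = new , bag′-new ; only = only }
    where
    open CliqueTree T
    open NewLeaf tree p
    bag′ : Grown.Node → Subset n
    bag′ = snoc bag B
    bag′-old : ∀ u → bag′ (inject₁ u) ≡ bag u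
    bag′-old = snoc-inject₁ bag B
    bag′-new : bag′ new ≡ B
    bag′-new = snoc-last bag B
    lift : ∀ v {a b} → PathIn (λ u → v ∈ bag u) a b → Grown.PathIn (λ u → v ∈ bag′ u) (inject₁ a) (inject₁ b)
    lift v = lift-path _ _ (λ a v∈ → subst (v ∈_) (sym (bag′-old a)) v∈)
    subtree′ : ∀ v → Grown.InducesSubtree (λ u → v ∈ bag′ u)
    subtree′ v a′ b′ v∈a′ v∈b′ with old-or-last a′ | old-or-last b′
    ... | inj₁ (a , refl) | inj₁ (b , refl) =
      lift v (subtree v a b (subst (v ∈_) (bag′-old a) v∈a′) (subst (v ∈_) (bag′-old b) v∈b′))
    ... | inj₁ (a , refl) | inj₂ refl = append-step (lift v (subtree v a p v∈a v∈p)) p-new v∈b′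
      where
      v∈a = subst (v ∈_) (bag′-old a) v∈a′
      v∈p = B-used⊆p v (subst (v ∈_) bag′-new v∈b′) (a , v∈a)
    ... | inj₂ refl | inj₁ (b , refl) = Grown.step v∈a′ new-p (lift v (subtree v p b v∈p v∈b))
      where
      v∈b = subst (v ∈_) (bag′-old b) v∈b′
      v∈p = B-used⊆p v (subst (v ∈_) bag′-new v∈a′) (b , v∈b)
    ... | inj₂ refl | inj₂ refl = Grown.here v∈a′
    on-nodes : (Q : Subset n → Set) → (∀ u → Q (bag u)) → Q B → ∀ u′ → Q (bag′ u′)
    on-nodes Q old-ok new-ok u′ with old-or-last u′
    ... | inj₁ (u , refl) rewrite bag′-old u = old-ok u
    ... | inj₂ refl rewrite bag′-new = new-ok
    on-edges : (Q : Subset n → Subset n → Set) → (∀ i → Q (bag (fsuc i)) (bag (parent i))) → Q B (bag p) →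
               ∀ i → Q (bag′ (fsuc i)) (bag′ (parent′ i))
    on-edges Q old-ok new-ok i with old-or-last i
    ... | inj₁ (j , refl) rewrite parent′-old j | bag′-old (fsuc j) | bag′-old (parent j) = old-ok j
    ... | inj₂ refl rewrite parent′-new | bag′-old p | bag′-new = new-ok
    T′ : CliqueTree
    T′ = record
      { tree = grown ; bag = bag′ ; bag-clique = on-nodes (IsClique G) bag-clique B-clique ; root-bag = root-bag
      ; subtree = subtree′ ; distinct = on-edges _≢_ distinct B≢p
      ; admissible = on-nodes Admissible admissible B-admissible ; shares = on-edges SharesAllButOne shares B-shares }
    only : ∀ u′ → (∃ λ u → bag′ u′ ≡ bag u) ⊎ bag′ u′ ≡ B
    only u′ with old-or-last u′
    ... | inj₁ (u , refl) = inj₁ (u , bag′-old u)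
    ... | inj₂ refl = inj₂ bag′-new

-- Hanging a good clique K below a tree T₀ whose bags meet K only inside
-- N ⊊ K, where N lies in the bag of a node p: the vertices of K ∖ N are
-- added one at a time.  The current set B ⊆ K becomes a new bag (child of
-- the last one) as soon as it has four vertices or equals K, so every new
-- bag is admissible and, once bags exceed four vertices, each differs from
-- its parent by exactly one vertex.
module Hanging {n : ℕ} (G : Graph n) (C K : Subset n) (K-clique : IsClique G K) (K-good : BagConditions.Good G K)
               (T₀ : CliqueTrees.CliqueTree G C) where
  open Subsets {n}
  open GraphFacts G
  open CliqueTrees G C
  open CliqueTree using (bag)

  record Related (T : CliqueTree) : Set where
    field
      keeps-old   : ∀ u → ∃ λ u′ → bag T u′ ≡ bag T₀ u
      old-or-in-K : ∀ u′ → (∃ λ u → bag T u′ ≡ bag T₀ u) ⊎ bag T u′ ⊆ K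

  related-extension : ∀ {T B} → Related T → B ⊆ K → (r : Extension T B) → Related (Extension.T′ r)
  related-extension {T} {B} rel B⊆K r = record { keeps-old = keeps-old′ ; old-or-in-K = old-or-in-K′ }
    where
    module rel = Related rel
    module r = Extension r
    keeps-old′ : ∀ u → ∃ λ u′ → bag r.T′ u′ ≡ bag T₀ u
    keeps-old′ u with rel.keeps-old u
    ... | u₁ , e₁ with r.keeps u₁
    ...   | u₂ , e₂ = u₂ , trans e₂ e₁
    old-or-in-K′ : ∀ u′ → (∃ λ u → bag r.T′ u′ ≡ bag T₀ u) ⊎ bag r.T′ u′ ⊆ K
    old-or-in-K′ u′ with r.only u′
    ... | inj₂ e = inj₂ (λ x∈ → B⊆K (subst (_ ∈_) e x∈))
    ... | inj₁ (u₁ , e₁) with rel.old-or-in-K u₁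
    ...   | inj₁ (u , e) = inj₁ (u , trans e₁ e)
    ...   | inj₂ ⊆K = inj₂ (λ x∈ → ⊆K (subst (_ ∈_) e₁ x∈))

  record Hung : Set where
    field
      T       : CliqueTree
      K-bag   : ∃ λ ν → bag T ν ≡ K
      related : Related T

  record Invariant (T : CliqueTree) (q : CliqueTree.Node T) (B : Subset n) : Set where
    field
      B⊆K             : B ⊆ K
      K-used          : ∀ u v → v ∈ bag T u → v ∈ K → v ∈ B × v ∈ bag T q
      small-or-inside : ∣ B ∣ ≤ 3 ⊎ B ⊆ bag T q
      related         : Related T

  module Step {T : CliqueTree} {q : CliqueTree.Node T} {B : Subset n} (inv : Invariant T q B)
              (w : Fin n) (w∈K : w ∈ K) (w∉B : w ∉ B) where
    open Invariant inv

    B′ : Subset n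
    B′ = B ∪ ⁅ w ⁆

    ∣B′∣ : ∣ B′ ∣ ≡ suc ∣ B ∣
    ∣B′∣ = ∣p∪⁅x⁆∣≡1+∣p∣ B w w∉B

    B′⊆K : B′ ⊆ K
    B′⊆K x∈ = [ B⊆K , (λ { refl → w∈K }) ]′ (∈p∪⁅x⁆⁻ x∈)

    -- bag q meets B′ exactly in B once B is large
    shares : SharesAllButOne B′ (bag T q)
    shares 5≤ with small-or-inside
    ... | inj₁ ∣B∣≤3 = ⊥-elim (ℕP.<⇒≱ (subst (5 ≤_) ∣B′∣ 5≤) (s≤s ∣B∣≤3))
    ... | inj₂ B⊆q = trans (cong ∣_∣ B′∩q≡B) (cong (_∸ 1) (sym ∣B′∣))
      where
      B′∩q≡B : B′ ∩ bag T q ≡ B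
      B′∩q≡B = SP.⊆-antisym (λ x∈ → let (x∈B′ , x∈q) = SP.x∈p∩q⁻ B′ _ x∈ in proj₁ (K-used q _ x∈q (B′⊆K x∈B′)))
                             (λ x∈B → SP.x∈p∩q⁺ (p⊆p∪⁅x⁆ x∈B , B⊆q x∈B))

    hang : 4 ≤ ∣ B′ ∣ ⊎ B′ ≡ K → Extension T B′
    hang large-or-K =
      add-leaf T q B′ (clique-⊆ B′⊆K K-clique) (λ v v∈B′ (u , v∈u) → proj₂ (K-used u v v∈u (B′⊆K v∈B′)))
               (λ B′≡q → w∉B (proj₁ (K-used q w (subst (w ∈_) B′≡q x∈p∪⁅x⁆) w∈K)))
               (good⇒admissible ([ inj₁ , (λ B′≡K → subst Good (sym B′≡K) K-good) ]′ large-or-K)) shares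

    after-hang : (r : Extension T B′) → Invariant (Extension.T′ r) (proj₁ (Extension.adds r)) B′
    after-hang r = record
      { B⊆K = B′⊆K ; K-used = K-used′ ; small-or-inside = inj₂ (λ x∈ → subst (_ ∈_) (sym ν-bag) x∈)
      ; related = related-extension related B′⊆K r }
      where
      open Extension r
      ν-bag = proj₂ adds
      K-used′ : ∀ u v → v ∈ bag T′ u → v ∈ K → v ∈ B′ × v ∈ bag T′ (proj₁ adds)
      K-used′ u v v∈u v∈K = v∈B′ , subst (v ∈_) (sym ν-bag) v∈B′
        where
        v∈B′ : v ∈ B′
        v∈B′ = [ (λ (u₀ , e) → p⊆p∪⁅x⁆ (proj₁ (K-used u₀ v (subst (v ∈_) e v∈u) v∈K)))
               , (λ e → subst (v ∈_) e v∈u) ]′ (only u)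

    continue : ∣ B′ ∣ ≤ 3 → Invariant T q B′
    continue small = record
      { B⊆K = B′⊆K ; K-used = λ u v v∈u v∈K → let (v∈B , v∈q) = K-used u v v∈u v∈K in p⊆p∪⁅x⁆ v∈B , v∈q ; small-or-inside = inj₁ small
      ; related = related }

  -- Add the vertices of K ∖ B one by one until K is a bag (f bounds the steps).
  grow : ∀ f {T q B} → ∣ K ∣ ≤ ∣ B ∣ + f → Invariant T q B → ¬ (K ⊆ B) → Hung
  grow f {T} {q} {B} bound inv K⊈B with ⊈⇒witness K⊈B
  ... | w , w∈K , w∉B = next f bound (K SP.⊆? B′) (4 ℕP.≤? ∣ B′ ∣)
    where
    open Step inv w w∈K w∉B
    shift : ∀ f → ∣ K ∣ ≤ ∣ B ∣ + suc f → ∣ K ∣ ≤ ∣ B′ ∣ + f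
    shift f bound rewrite ∣B′∣ = subst (∣ K ∣ ≤_) (ℕP.+-suc _ f) bound
    next : ∀ f → ∣ K ∣ ≤ ∣ B ∣ + f → Dec (K ⊆ B′) → Dec (4 ≤ ∣ B′ ∣) → Hung
    next zero bound _ _ =
      ⊥-elim (ℕP.<⇒≱ (proper⇒smaller (Invariant.B⊆K inv) w∈K w∉B) (subst (∣ K ∣ ≤_) (ℕP.+-identityʳ _) bound))
    next (suc f) bound (yes K⊆B′) _ = record
      { T = Extension.T′ r ; K-bag = proj₁ (Extension.adds r) , trans (proj₂ (Extension.adds r)) B′≡K
      ; related = Invariant.related (after-hang r) }
      where
      B′≡K = SP.⊆-antisym B′⊆K K⊆B′
      r = hang (inj₂ B′≡K)
    next (suc f) bound (no K⊈B′) (yes large) = grow f (shift f bound) (after-hang (hang (inj₁ large))) K⊈B′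
    next (suc f) bound (no K⊈B′) (no ¬large) = grow f (shift f bound) (continue (ℕP.≤-pred (ℕP.≰⇒> ¬large))) K⊈B′

  hang-below : (N : Subset n) (p : CliqueTree.Node T₀) → N ⊆ K → ¬ (K ⊆ N) → N ⊆ bag T₀ p →
               (∀ u v → v ∈ bag T₀ u → v ∈ K → v ∈ N) → Hung
  hang-below N p N⊆K K⊈N N⊆p K-used⊆N = grow ∣ K ∣ (ℕP.m≤n+m _ _) start K⊈N
    where
    start : Invariant T₀ p N
    start = record
      { B⊆K = N⊆K ; K-used = λ u v v∈u v∈K → K-used⊆N u v v∈u v∈K , N⊆p (K-used⊆N u v v∈u v∈K)
      ; small-or-inside = inj₂ N⊆p
      ; related = record { keeps-old = λ u → u , refl ; old-or-in-K = λ u → inj₁ (u , refl) } }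

-- Nice clique trees for G[S], for every S ⊇ C whose maximal cliques are all
-- good, built by induction on |S|: remove the exclusive vertices of a leaf
-- clique K, decompose the rest, and hang K back on.
module Construction {n : ℕ} (G : Graph n) (chordal : Chordal G) (C : Subset n) (C-clique : IsClique G C)
                    (C-good : BagConditions.Good G C) where
  open Subsets {n}
  open GraphFacts G
  open LeafCliques G chordal
  open CliqueTrees G C
  open CliqueTree using (bag)

  record Decomposition (S : Subset n) : Set where
    field
      T      : CliqueTree
      bag⊆S  : ∀ u → bag T u ⊆ S
      covers : ∀ Q → Q ⊆ S → IsClique G Q → ∃ λ u → Q ⊆ bag T u

  trivial-decomposition : ∀ S → S ⊆ C → C ⊆ S → Decomposition S
  trivial-decomposition S S⊆C C⊆S = record
    { T = root-only C-clique (good⇒admissible C-good) ; bag⊆S = λ _ x∈C → C⊆S x∈C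
    ; covers = λ Q Q⊆S _ → fzero , λ x∈Q → S⊆C (Q⊆S x∈Q) }

  module Pruning (S : Subset n) (C⊆S : C ⊆ S) (S-good : AllGood S) (L : LeafClique S C) where
    open LeafClique L

    W S′ N : Subset n
    W = K ─ P
    S′ = S ─ W
    N = K ∩ P

    W-exclusive : ∀ {y} → y ∈ W → ∀ z → z ∈ S → Adj G y z → z ∈ K
    W-exclusive {y} y∈W with exclusive y (SP.p─q⊆p K P y∈W)
    ... | inj₁ y∈P = ⊥-elim (∈p─q⇒∉q K P y∈W y∈P)
    ... | inj₂ (_ , nbrs) = nbrs

    ∉W⇒∈P : ∀ {x} → x ∈ K → x ∉ W → x ∈ P
    ∉W⇒∈P {x} x∈K x∉W with x SP.∈? P
    ... | yes x∈P = x∈P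
    ... | no x∉P = ⊥-elim (x∉W (SP.x∈p∧x∉q⇒x∈p─q x∈K x∉P))

    S′⊆S : S′ ⊆ S
    S′⊆S = SP.p─q⊆p S W

    smaller : ∣ S′ ∣ < ∣ S ∣
    smaller = proper⇒smaller S′⊆S (K⊆S w₀∈K) (λ w₀∈S′ → ∈p─q⇒∉q S W w₀∈S′ (SP.x∈p∧x∉q⇒x∈p─q w₀∈K w₀∉P))

    C⊆S′ : C ⊆ S′
    C⊆S′ {c} c∈C = SP.x∈p∧x∉q⇒x∈p─q (C⊆S c∈C) c∉W
      where
      c∉W : c ∉ W
      c∉W c∈W with exclusive c (SP.p─q⊆p K P c∈W)
      ... | inj₁ c∈P = ∈p─q⇒∉q K P c∈W c∈P
      ... | inj₂ (c∉C , _) = c∉C c∈C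

    K-good : Good K
    K-good = S-good K K⊆S K-clique K-maximal

    -- A maximal clique M of G[S′] is maximal in G[S] unless some w ∈ W is
    -- complete to it; then M ⊆ N(w) ⊆ K forces M = P, and as P ⊆ K this
    -- means P = C, which is good.
    S′-good : AllGood S′
    S′-good M M⊆S′ M-clique M-maximal
      with FP.any? (λ y → y SP.∈? W ×-dec FP.all? (λ m → m SP.∈? M →-dec adj? m y))
    ... | no none = S-good M (λ m∈ → S′⊆S (M⊆S′ m∈)) M-clique maximal-in-S
      where
      maximal-in-S : ∀ y → y ∈ S → Complete y M → y ∈ M
      maximal-in-S y y∈S complete with y SP.∈? W
      ... | yes y∈W = ⊥-elim (none (y , y∈W , complete))
      ... | no y∉W = M-maximal y (SP.x∈p∧x∉q⇒x∈p─q y∈S y∉W) complete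
    ... | yes (y , y∈W , complete) = [ (λ P⊈K → ⊥-elim (P⊈K (λ p∈P → M⊆K (P⊆M p∈P))))
                                     , (λ P≡C → subst Good (sym (trans M≡P P≡C)) C-good) ]′ P-root-or-⊈K
      where
      M⊆K : M ⊆ K
      M⊆K m∈M = W-exclusive y∈W _ (S′⊆S (M⊆S′ m∈M)) (Adj-sym (complete _ m∈M))
      M⊆P : M ⊆ P
      M⊆P m∈M = ∉W⇒∈P (M⊆K m∈M) (∈p─q⇒∉q S W (M⊆S′ m∈M))
      P⊆M : P ⊆ M
      P⊆M {p} p∈P with p SP.∈? M
      ... | yes p∈M = p∈M
      ... | no p∉M = M-maximal p (SP.x∈p∧x∉q⇒x∈p─q (P⊆S p∈P) (λ p∈W → ∈p─q⇒∉q K P p∈W p∈P))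
                       (λ m m∈M → P-clique m p (M⊆P m∈M) p∈P (λ m≡p → p∉M (subst (_∈ M) m≡p m∈M)))
      M≡P : M ≡ P
      M≡P = SP.⊆-antisym M⊆P P⊆M

    -- Hang K below a bag containing N: cliques meeting W lie in K, the others in G[S′].
    extend : Decomposition S′ → Decomposition S
    extend D′ = record { T = H.T ; bag⊆S = bag⊆S ; covers = covers }
      where
      module D′ = Decomposition D′
      N-place = D′.covers N (λ x∈N → let (x∈K , x∈P) = SP.x∈p∩q⁻ K P x∈N in
                                       SP.x∈p∧x∉q⇒x∈p─q (K⊆S x∈K) (λ x∈W → ∈p─q⇒∉q K P x∈W x∈P))
                            (clique-⊆ (SP.p∩q⊆p K P) K-clique)
      K-used⊆N : ∀ u v → v ∈ bag D′.T u → v ∈ K → v ∈ N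
      K-used⊆N u v v∈u v∈K = SP.x∈p∩q⁺ (v∈K , ∉W⇒∈P v∈K (∈p─q⇒∉q S W (D′.bag⊆S u v∈u)))
      H : Hanging.Hung G C K K-clique K-good D′.T
      H = Hanging.hang-below G C K K-clique K-good D′.T N (proj₁ N-place) (SP.p∩q⊆p K P)
            (λ K⊆N → w₀∉P (SP.p∩q⊆q K P (K⊆N w₀∈K))) (proj₂ N-place) K-used⊆N
      module H = Hanging.Hung H
      module R = Hanging.Related H.related
      bag⊆S : ∀ u → bag H.T u ⊆ S
      bag⊆S u with R.old-or-in-K u
      ... | inj₁ (u₀ , e) = λ x∈ → S′⊆S (D′.bag⊆S u₀ (subst (_ ∈_) e x∈))
      ... | inj₂ ⊆K = λ x∈ → K⊆S (⊆K x∈)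
      covers : ∀ Q → Q ⊆ S → IsClique G Q → ∃ λ u → Q ⊆ bag H.T u
      covers Q Q⊆S Q-clique with FP.any? (λ q → q SP.∈? Q ×-dec q SP.∈? W)
      ... | yes (q , q∈Q , q∈W) = proj₁ H.K-bag , λ {x} x∈Q → subst (x ∈_) (sym (proj₂ H.K-bag)) (Q⊆K x x∈Q)
        where
        Q⊆K : ∀ x → x ∈ Q → x ∈ K
        Q⊆K x x∈Q with x FP.≟ q
        ... | yes refl = SP.p─q⊆p K P q∈W
        ... | no x≢q = W-exclusive q∈W x (Q⊆S x∈Q) (Q-clique q x q∈Q x∈Q (λ e → x≢q (sym e)))
      ... | no avoids-W with D′.covers Q (λ {x} x∈Q → SP.x∈p∧x∉q⇒x∈p─q (Q⊆S x∈Q) (λ x∈W → avoids-W (x , x∈Q , x∈W))) Q-clique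
      ...   | u₀ , Q⊆u₀ with R.keeps-old u₀
      ...     | u , e = u , λ x∈ → subst (_ ∈_) (sym e) (Q⊆u₀ x∈)

  decompose : ∀ f S → ∣ S ∣ ≤ f → C ⊆ S → AllGood S → Decomposition S
  decompose f S |S|≤f C⊆S S-good with S SP.⊆? C
  ... | yes S⊆C = trivial-decomposition S S⊆C C⊆S
  ... | no S⊈C with ⊈⇒witness S⊈C
  ...   | s , s∈S , s∉C with f
  ...     | zero = ⊥-elim (ℕP.<⇒≱ (nonempty⇒positive s∈S) |S|≤f)
  ...     | suc f′ = extend (decompose f′ S′ (ℕP.≤-pred (ℕP.≤-trans smaller |S|≤f)) C⊆S′ S′-good)
    where open Pruning S C⊆S S-good (leaf-clique ∣ S ∣ S C ℕP.≤-refl C⊆S C-clique s s∈S s∉C)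

  -- A decomposition of G[S], for S containing every non-isolated vertex, is a
  -- tree-decomposition of G: each edge is a 2-clique of G[S], hence in a bag.
  tree-decomposition : ∀ S → (∀ v v′ → Adj G v v′ → v ∈ S) → Decomposition S → TreeDecomposition G
  tree-decomposition S edges⊆S D = record
    { tree = CliqueTree.tree T ; bag = bag T ; adj-iff = adj-iff ; subtree = CliqueTree.subtree T }
    where
    open Decomposition D
    adj-iff : ∀ v v′ → v ≢ v′ → Adj G v v′ ⇔ (∃ λ u → v ∈ bag T u × v′ ∈ bag T u)
    adj-iff v v′ v≢v′ = mk⇔ in-a-bag (λ (u , v∈u , v′∈u) → CliqueTree.bag-clique T u v v′ v∈u v′∈u v≢v′)
      where
      in-a-bag : Adj G v v′ → ∃ λ u → v ∈ bag T u × v′ ∈ bag T u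
      in-a-bag v~v′ with covers (⁅ v ⁆ ∪ ⁅ v′ ⁆) edge⊆S edge-clique
        where
        edge⊆S : ⁅ v ⁆ ∪ ⁅ v′ ⁆ ⊆ S
        edge⊆S x∈ with ∈p∪⁅x⁆⁻ x∈
        ... | inj₁ x∈⁅v⁆ rewrite SP.x∈⁅y⁆⇒x≡y v x∈⁅v⁆ = edges⊆S v v′ v~v′
        ... | inj₂ refl = edges⊆S v′ v (Adj-sym v~v′)
        edge-clique : IsClique G (⁅ v ⁆ ∪ ⁅ v′ ⁆)
        edge-clique x y x∈ y∈ x≢y with ∈p∪⁅x⁆⁻ x∈ | ∈p∪⁅x⁆⁻ y∈
        ... | inj₂ refl | inj₂ refl = ⊥-elim (x≢y refl)
        ... | inj₂ refl | inj₁ y∈⁅v⁆ rewrite SP.x∈⁅y⁆⇒x≡y v y∈⁅v⁆ = Adj-sym v~v′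
        ... | inj₁ x∈⁅v⁆ | inj₂ refl rewrite SP.x∈⁅y⁆⇒x≡y v x∈⁅v⁆ = v~v′
        ... | inj₁ x∈⁅v⁆ | inj₁ y∈⁅v⁆ rewrite SP.x∈⁅y⁆⇒x≡y v x∈⁅v⁆ | SP.x∈⁅y⁆⇒x≡y v y∈⁅v⁆ = ⊥-elim (x≢y refl)
      ... | u , edge⊆u = u , edge⊆u (p⊆p∪⁅x⁆ (SP.x∈⁅x⁆ v)) , edge⊆u x∈p∪⁅x⁆

-- In a 4-chordal graph every maximal clique of G[V₀], V₀ the set of
-- non-isolated vertices, is good: it is a maximal clique of G, and an edge
-- inside it lies in a 4-clique, which forces a third vertex.
module NonIsolated {n : ℕ} (G : Graph n) (four-chordal : FourChordal G) where
  open Subsets {n}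
  open GraphFacts G
  open BagConditions G

  V₀ : Subset n
  V₀ = setOf (λ x → FP.any? (adj? x))

  edges⊆V₀ : ∀ v v′ → Adj G v v′ → v ∈ V₀
  edges⊆V₀ v v′ v~v′ = ∈setOf⁺ (λ x → FP.any? (adj? x)) (v′ , v~v′)

  complete⇒∈ : ∀ {M} → IsMaximalClique G M → ∀ y → Complete y M → y ∈ M
  complete⇒∈ {M} (M-clique , maximal) y complete = maximal (M ∪ ⁅ y ⁆) bigger-clique p⊆p∪⁅x⁆ x∈p∪⁅x⁆
    where
    bigger-clique : IsClique G (M ∪ ⁅ y ⁆)
    bigger-clique u v u∈ v∈ u≢v with ∈p∪⁅x⁆⁻ u∈ | ∈p∪⁅x⁆⁻ v∈
    ... | inj₁ u∈M | inj₁ v∈M = M-clique u v u∈M v∈M u≢v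
    ... | inj₁ u∈M | inj₂ refl = complete u u∈M
    ... | inj₂ refl | inj₁ v∈M = Adj-sym (complete v v∈M)
    ... | inj₂ refl | inj₂ refl = ⊥-elim (u≢v refl)

  beyond-pair : ∀ {M} → IsMaximalClique G M → ∀ {a₁ a₂ y} → y ≢ a₁ → y ≢ a₂ → Adj G a₁ y → Adj G a₂ y →
                ∃ λ m → m ∈ M × m ≢ a₁ × m ≢ a₂
  beyond-pair {M} M-maximal {a₁} {a₂} {y} y≢a₁ y≢a₂ a₁~y a₂~y
    with FP.any? (λ m → m SP.∈? M ×-dec ¬? (m FP.≟ a₁) ×-dec ¬? (m FP.≟ a₂))
  ... | yes other = other
  ... | no none = ⊥-elim (none (y , complete⇒∈ M-maximal y complete , y≢a₁ , y≢a₂))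
    where
    complete : Complete y M
    complete m m∈M with m FP.≟ a₁ | m FP.≟ a₂
    ... | yes refl | _ = a₁~y
    ... | no _ | yes refl = a₂~y
    ... | no m≢a₁ | no m≢a₂ = ⊥-elim (none (m , m∈M , m≢a₁ , m≢a₂))

  three≤maximal : ∀ {M m y} → IsMaximalClique G M → m ∈ M → Adj G m y → 3 ≤ ∣ M ∣
  three≤maximal {M} {m} M-maximal m∈M m~y with beyond-pair M-maximal (Adj⇒≢ (Adj-sym m~y)) (Adj⇒≢ (Adj-sym m~y)) m~y m~y
  ... | m₂ , m₂∈M , m₂≢m , _ with proj₂ four-chordal m m₂ (proj₁ M-maximal m m₂ m∈M m₂∈M (λ e → m₂≢m (sym e)))
  ...   | Q , Q-clique , ∣Q∣≡4 , m∈Q , m₂∈Q with third-element (subst (3 ≤_) (sym ∣Q∣≡4) (ℕP.n≤1+n 3)) m m₂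
  ...     | q , q∈Q , q≢m , q≢m₂ with beyond-pair M-maximal q≢m q≢m₂ (Q-clique m q m∈Q q∈Q (λ e → q≢m (sym e)))
                                                       (Q-clique m₂ q m₂∈Q q∈Q (λ e → q≢m₂ (sym e)))
  ...       | m₃ , m₃∈M , m₃≢m , m₃≢m₂ =
    three-distinct⇒3≤∣p∣ m∈M m₂∈M m₃∈M (λ e → m₂≢m (sym e)) (λ e → m₃≢m (sym e)) (λ e → m₃≢m₂ (sym e))

  -- (V₀ must be nonempty: otherwise the empty clique is maximal in G[V₀])
  V₀-good : 1 ≤ ∣ V₀ ∣ → AllGood V₀
  V₀-good V₀-nonempty M M⊆V₀ M-clique M-maximal-in-V₀ with FP.any? (λ m → m SP.∈? M)
  ... | no M-empty = ⊥-elim (M-empty (x , M-maximal-in-V₀ x x∈V₀ (λ m m∈M → ⊥-elim (M-empty (m , m∈M)))))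
    where
    x∈V₀-witness = larger⇒witness {p = Data.Fin.Subset.⊥} (subst (_< ∣ V₀ ∣) (sym (SP.∣⊥∣≡0 n)) V₀-nonempty)
    x = proj₁ x∈V₀-witness
    x∈V₀ = proj₁ (proj₂ x∈V₀-witness)
  ... | yes (m , m∈M) with ∈setOf⁻ (λ x → FP.any? (adj? x)) (M⊆V₀ m∈M) | 4 ℕP.≤? ∣ M ∣
  ...   | _ | yes 4≤ = inj₁ 4≤
  ...   | y , m~y | no ¬4≤ = inj₂ (M-maximal , ℕP.≤-antisym (ℕP.≤-pred (ℕP.≰⇒> ¬4≤)) (three≤maximal M-maximal m∈M m~y))
    where
    -- a vertex outside M completing it would be a neighbour of m, so in V₀
    M-maximal : IsMaximalClique G M
    M-maximal = M-clique , λ D D-clique M⊆D {z} z∈D → in-M D D-clique M⊆D z z∈D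
      where
      in-M : ∀ D → IsClique G D → M ⊆ D → ∀ z → z ∈ D → z ∈ M
      in-M D D-clique M⊆D z z∈D with z SP.∈? M
      ... | yes z∈M = z∈M
      ... | no z∉M = M-maximal-in-V₀ z (edges⊆V₀ z m (Adj-sym (complete m m∈M))) complete
        where
        complete : Complete z M
        complete k k∈M = D-clique k z (M⊆D k∈M) z∈D (λ k≡z → z∉M (subst (_∈ M) k≡z k∈M))

proposition5 : (n : ℕ) (G : Graph n) → FourChordal G → (C : Subset n) →
    ((HasMaximal3Clique G × IsMaximal3Clique G C) ⊎
     (¬ HasMaximal3Clique G × IsClique G C × 4 ≤ ∣ C ∣)) →
    Σ (TreeDecomposition G) (λ T →
      IsNice T × TreeDecomposition.bag T (TreeDecomposition.root T) ≡ C)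
proposition5 n G four-chordal C root-choice =
  tree-decomposition V₀ edges⊆V₀ D , (distinct , admissible , shares , root-is-max3) , root-bag
  where
  open GraphFacts G
  open BagConditions G
  open NonIsolated G four-chordal
  C-clique : IsClique G C
  C-clique = [ (λ (_ , C-max3) → proj₁ (proj₁ C-max3)) , (λ (_ , C-clique , _) → C-clique) ]′ root-choice
  C-good : Good C
  C-good = [ (λ (_ , C-max3) → inj₂ C-max3) , (λ (_ , _ , 4≤∣C∣) → inj₁ 4≤∣C∣) ]′ root-choice
  -- each c ∈ C has a neighbour in C, which has at least three vertices
  3≤∣C∣ = proj₁ (good⇒admissible C-good)
  C⊆V₀ : C ⊆ V₀
  C⊆V₀ {c} c∈C with Subsets.third-element 3≤∣C∣ c c
  ... | d , d∈C , d≢c , _ = edges⊆V₀ c d (C-clique c d c∈C d∈C (λ e → d≢c (sym e)))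
  open Construction G (proj₁ four-chordal) C C-clique C-good
  D = decompose n V₀ (SP.∣p∣≤n V₀) C⊆V₀ (V₀-good (ℕP.≤-trans (s≤s z≤n) (ℕP.≤-trans 3≤∣C∣ (SP.p⊆q⇒∣p∣≤∣q∣ C⊆V₀))))
  open CliqueTrees G C using (module CliqueTree)
  open CliqueTree (Decomposition.T D)
  root-is-max3 : HasMaximal3Clique G → IsMaximal3Clique G (bag root)
  root-is-max3 has-max3 = [ (λ (_ , C-max3) → subst (IsMaximal3Clique G) (sym root-bag) C-max3)
                          , (λ (no-max3 , _) → ⊥-elim (no-max3 has-max3)) ]′ root-choice
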